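{- For every integer $n\geq 1$, let $\pi_{0,n}=[n\,(n-1)\,\cdots\,2\,1]\in \mathrm{I}_n$ be the longest permutation. Then $$W(\pi_{0,n})=\mathrm{D}_n .$$ That is, a permutation $w\in \mathrm{S}_n$ satisfies $w\cdot e=\pi_{0,n}$ and $\ell(w)=\ell_{(n)}(\pi_{0,n})$ if and only if $w\in\mathrm{D}_n$.
   Context: $\mathrm{S}_n$ is the symmetric group on $[n]=\{1,\dots,n\}$; a permutation $w$ is written in one-line notation $[w(1)\,w(2)\cdots w(n)]$, and cycles are written in parentheses. Products are compositions, $(uv)(x)=u(v(x))$. For $1\le i\le n-1$, $s_i=(i,i+1)$ is the simple transposition. $\mathrm{I}_n$ denotes the set of involutions ($w^2=\mathrm{id}$) in $\mathrm{S}_n$, and $e=[1\,2\cdots n]$ is the identity. $\ell(w)=\#\{(a,b): a<b,\ w(a)>w(b)\}$ is the number of inversions, $\mathrm{exc}(w)=\#\{a: w(a)>a\}$, and for $\pi\in\mathrm{I}_n$, $\ell_{(n)}(\pi)=\frac{\ell(\pi)+\mathrm{exc}(\pi)}{2}$. Action of simple transpositions on involutions: for $\pi\in\mathrm{I}_n$ and $1\le i\le n-1$, set $s_i\cdot\pi=\pi$ if $\pi^{ -1}(i+1)<\pi^{ -1}(i)$; $s_i\cdot\pi=s_i\pi$ if $\pi(i)=i$ and $\pi(i+1)=i+1$; and $s_i\cdot\pi=s_i\pi s_i$ otherwise. This operation satisfies $s_i\cdot(s_i\cdot\pi)=s_i\cdot\pi$, $s_i\cdot(s_j\cdot\pi)=s_j\cdot(s_i\cdot\pi)$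 for $|i-j|>1$, and $s_i\cdot(s_{i+1}\cdot(s_i\cdot\pi))=s_{i+1}\cdot(s_i\cdot(s_{i+1}\cdot\pi))$; hence for $w\in\mathrm{S}_n$ with any reduced expression $w=s_{i_1}s_{i_2}\cdots s_{i_k}$, $w\cdot\pi:=s_{i_1}\cdot(s_{i_2}\cdot(\cdots(s_{i_k}\cdot\pi)))$ is well defined. The $W$-set of $\pi\in\mathrm{I}_n$ is $W(\pi)=\{w\in\mathrm{S}_n: w\cdot e=\pi \text{ and } \ell(w)=\ell_{(n)}(\pi)\}$. $\mathrm{D}_n$ is the set of $w\in\mathrm{S}_n$ such that for every integer $i$ with $1\le i\le n/2$: $w^{ -1}(n+1-i)<w^{ -1}(i)$, and there is no $j$ with $i<j<n+1-i$ and $w^{ -1}(n+1-i)<w^{ -1}(j)<w^{ -1}(i)$. (In one-line notation: $n+1-i$ appears before $i$, and no value strictly between $i$ and $n+1-i$ appears between them.) -}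

module Defs where

open import Data.Nat as ℕ using (ℕ; zero; suc; _+_; _*_; _≤_; _/_)
open import Data.Fin as Fin using (Fin; toℕ; inject₁; opposite; _<?_; _≟_)
open import Data.Fin.Permutation as P using (Permutation′; _⟨$⟩ʳ_; _⟨$⟩ˡ_; _∘ₚ_; transpose)
open import Data.List using (List; []; _∷_; length; sum; map; filter; allFin)
open import Data.Product using (_×_; Σ-syntax)
open import Relation.Binary.PropositionalEquality using (_≡_)
open import Relation.Nullary using (¬_; yes; no)
open import Relation.Nullary.Decidable using (_×-dec_)

-- Conventions: [n] = {1,…,n} is modelled by Fin n = {0,…,n-1} (shift by one).
-- A permutation of [n] is a stdlib Permutation′ n (a bijection Fin n ↔ Fin n);
-- w(x) is  w ⟨$⟩ʳ x  and  w⁻¹(x)  is  w ⟨$⟩ˡ x.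

-- Paper's product: (u · v)(x) = u (v x).  (stdlib's _∘ₚ_ is diagrammatic.)
_·_ : ∀ {n} → Permutation′ n → Permutation′ n → Permutation′ n
u · v = v ∘ₚ u

_≈ₚ_ : ∀ {n} → Permutation′ n → Permutation′ n → Set
u ≈ₚ v = ∀ x → u ⟨$⟩ʳ x ≡ v ⟨$⟩ʳ x

e : ∀ {n} → Permutation′ n
e = P.id

-- Simple transposition: for n = suc m, an index k : Fin m stands for
-- s_{k+1} = (k+1, k+2) in the paper's 1-based notation, i.e. it swaps
-- the 0-based points  inject₁ k  and  suc k.
s : ∀ {m} → Fin m → Permutation′ (suc m)
s k = transpose (inject₁ k) (Fin.suc k)

ℓ : ∀ {n} → Permutation′ n → ℕ
ℓ {n} w = length (filter (λ ab → (Data.Product.proj₁ ab <? Data.Product.proj₂ ab)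
                               ×-dec (w ⟨$⟩ʳ Data.Product.proj₂ ab <? w ⟨$⟩ʳ Data.Product.proj₁ ab))
                    (Data.List.cartesianProduct (allFin n) (allFin n)))

exc : ∀ {n} → Permutation′ n → ℕ
exc {n} w = length (filter (λ a → a <? w ⟨$⟩ʳ a) (allFin n))

ℓ₍ₙ₎ : ∀ {n} → Permutation′ n → ℕ
ℓ₍ₙ₎ π = (ℓ π + exc π) / 2

sdot : ∀ {m} → Fin m → Permutation′ (suc m) → Permutation′ (suc m)
sdot k π with (π ⟨$⟩ˡ Fin.suc k) <? (π ⟨$⟩ˡ inject₁ k)
... | yes _ = π
... | no _ with (π ⟨$⟩ʳ inject₁ k ≟ inject₁ k) ×-dec (π ⟨$⟩ʳ Fin.suc k ≟ Fin.suc k)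
...   | yes _ = s k · π
...   | no _  = (s k · π) · s k

word : ∀ {m} → List (Fin m) → Permutation′ (suc m)
word []       = e
word (k ∷ ks) = s k · word ks

act : ∀ {m} → List (Fin m) → Permutation′ (suc m) → Permutation′ (suc m)
act []       π = π
act (k ∷ ks) π = sdot k (act ks π)

ReducedWord : ∀ {m} → Permutation′ (suc m) → List (Fin m) → Set
ReducedWord w ks = (word ks ≈ₚ w) × (length ks ≡ ℓ w)

-- w · π = ρ: computing w · π through a reduced expression ks of w gives ρ.
-- (The paper shows w · π is independent of the chosen reduced expression,
--  so we take a reduced expression as witness.)
DotEq : ∀ {m} → Permutation′ (suc m) → Permutation′ (suc m) → Permutation′ (suc m) → Set
DotEq {m} w π ρ = Σ[ ks ∈ List (Fin m) ] (ReducedWord w ks × (act ks π ≈ₚ ρ))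

InW : ∀ {m} → Permutation′ (suc m) → Permutation′ (suc m) → Set
InW π w = DotEq w e π × (ℓ w ≡ ℓ₍ₙ₎ π)

π₀ : ∀ {n} → Permutation′ n
π₀ = P.reverse

-- D_n: for every 1 ≤ i ≤ n/2 (0-based: toℕ v + 1 ≤ n/2, with partner
-- opposite v, the 0-based version of n+1-i), w⁻¹(n+1-i) < w⁻¹(i) and no j with
-- i < j < n+1-i has w⁻¹(n+1-i) < w⁻¹(j) < w⁻¹(i).
InD : ∀ {n} → Permutation′ n → Set
InD {n} w = ∀ (v : Fin n) → 2 * (toℕ v + 1) ≤ n →
    ((w ⟨$⟩ˡ opposite v) Fin.< (w ⟨$⟩ˡ v))
  × (∀ (j : Fin n) → v Fin.< j → j Fin.< opposite v →
       ¬ (((w ⟨$⟩ˡ opposite v) Fin.< (w ⟨$⟩ˡ j)) × ((w ⟨$⟩ˡ j) Fin.< (w ⟨$⟩ˡ v))))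

-- Write p = w⁻¹, so that p x is the position of the value x in the one-line notation of w.
-- Then w ∈ W(π) iff (1) for every 2-cycle a < π a of π the value π a comes before a,
-- (2) no value strictly between a and π a sits between them, and (3) for two cycles with
-- a ≤ π a, b ≤ π b, a < b and π a < π b, the value a comes before π b.
-- Along a reduced word, s_k · π either leaves π unchanged (impossible once both lengths are
-- tight), multiplies π by s_k at two fixed points, or conjugates it; in the last two cases
-- ℓ_(n) grows by one and (1)–(3) are preserved. Conversely, if w⁻¹(k+1) < w⁻¹(k) then
-- (1)–(3) pass to s_k w and the involution π′ with s_k · π′ = π, so induction on ℓ(w)
-- produces a reduced word; when there is no such k, w = e and (1) forces π = e.
-- For π₀ every pair a < b is reversed, so (3) is vacuous and (1), (2) define D_n.
module Submission where

open import Defs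
open import Data.Empty using (⊥; ⊥-elim)
open import Data.Fin as Fin using (Fin; toℕ; inject₁; opposite; _<_; _≤_; _<?_)
import Data.Fin.Properties as Fin
open import Data.Fin.Permutation as Perm using (Permutation′; _⟨$⟩ʳ_; _⟨$⟩ˡ_)
import Data.Fin.Permutation.Components as PC
open import Data.List using (List; []; _∷_; length; map; filter; _++_; tabulate; allFin; cartesianProduct)
import Data.List.Properties as List
open import Data.Nat as ℕ using (ℕ; zero; suc; _+_; _*_; _∸_; z≤n; s≤s; _/_)
open import Data.Nat.DivMod using (m/n≡1+[m∸n]/n)
import Data.Nat.Properties as ℕ
open import Data.Nat.Solver using (module +-*-Solver)
open import Algebra.Properties.CommutativeMonoid.Sum ℕ.+-0-commutativeMonoid
  using (sum; sum-cong-≗; sum-remove; sum-replicate-zero; sum-permute; ∑-comm)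
open import Data.Product using (Σ-syntax; _×_; _,_; proj₁; proj₂)
open import Data.Sum using (_⊎_; inj₁; inj₂)
open import Function using (_∘_; id)
open import Relation.Binary.Definitions using (tri<; tri≈; tri>)
open import Relation.Binary.PropositionalEquality
open import Relation.Nullary using (¬_; Dec; yes; no)
open import Relation.Nullary.Decidable using (dec-true; dec-false; _×-dec_)
open import Relation.Unary using (Decidable)

private
  variable
    n : ℕ

≮∧≢⇒> : {a b : Fin n} → ¬ a < b → a ≢ b → b < a
≮∧≢⇒> {a = a} {b} a≮b a≢b with Fin.<-cmp a b
... | tri< a<b _ _ = ⊥-elim (a≮b a<b)
... | tri≈ _ a≡b _ = ⊥-elim (a≢b a≡b)
... | tri> _ _ b<a = b<a

≤⇒<⊎≡ : {a b : Fin n} → a ≤ b → a < b ⊎ a ≡ b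
≤⇒<⊎≡ {a = a} {b} a≤b with Fin.<-cmp a b
... | tri< a<b _ _ = inj₁ a<b
... | tri≈ _ a≡b _ = inj₂ a≡b
... | tri> _ _ b<a = ⊥-elim (ℕ.<⇒≱ b<a a≤b)

≤⊎> : (a b : Fin n) → a ≤ b ⊎ b < a
≤⊎> a b with Fin.<-cmp a b
... | tri< a<b _ _ = inj₁ (ℕ.<⇒≤ a<b)
... | tri≈ _ a≡b _ = inj₁ (Fin.≤-reflexive a≡b)
... | tri> _ _ b<a = inj₂ b<a

both-or-not : {A B : Set} → Dec A → Dec B → (A × B) ⊎ (A → B → ⊥)
both-or-not (yes a) (yes b) = inj₁ (a , b)
both-or-not (no ¬a) _       = inj₂ (λ a _ → ¬a a)
both-or-not (yes _) (no ¬b) = inj₂ (λ _ b → ¬b b)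

-- Adjacent transpositions

transpose-matchˡ : (i j : Fin n) → PC.transpose i j i ≡ j
transpose-matchˡ i j rewrite dec-true (i Fin.≟ i) refl = refl

transpose-matchʳ : (i j : Fin n) → i ≢ j → PC.transpose i j j ≡ i
transpose-matchʳ i j i≢j
  rewrite dec-false (j Fin.≟ i) (λ j≡i → i≢j (sym j≡i)) | dec-true (j Fin.≟ j) refl = refl

transpose-other : (i j x : Fin n) → x ≢ i → x ≢ j → PC.transpose i j x ≡ x
transpose-other i j x x≢i x≢j rewrite dec-false (x Fin.≟ i) x≢i | dec-false (x Fin.≟ j) x≢j = refl

module Adjacent {m : ℕ} (k : Fin m) where

  k₀ k₁ : Fin (suc m)
  k₀ = inject₁ k
  k₁ = Fin.suc k

  k₀<k₁ : k₀ < k₁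
  k₀<k₁ = s≤s (ℕ.≤-reflexive (Fin.toℕ-inject₁ k))

  k₀≢k₁ : k₀ ≢ k₁
  k₀≢k₁ = Fin.<⇒≢ k₀<k₁

  nothing-between : ∀ (x : Fin (suc m)) → k₀ < x → x < k₁ → ⊥
  nothing-between x k₀<x x<k₁ =
    ℕ.<-irrefl refl (ℕ.<-≤-trans (subst (ℕ._< toℕ x) (Fin.toℕ-inject₁ k) k₀<x) (ℕ.≤-pred x<k₁))

  <k₁⇒<k₀ : ∀ {x : Fin (suc m)} → x < k₁ → x ≢ k₀ → x < k₀
  <k₁⇒<k₀ {x} x<k₁ x≢k₀ = ≮∧≢⇒> {a = k₀} {b = x} (λ k₀<x → nothing-between x k₀<x x<k₁) (λ e → x≢k₀ (sym e))

  k₀<⇒k₁< : ∀ {x : Fin (suc m)} → k₀ < x → x ≢ k₁ → k₁ < x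
  k₀<⇒k₁< {x} k₀<x x≢k₁ = ≮∧≢⇒> {a = x} {b = k₁} (λ x<k₁ → nothing-between x k₀<x x<k₁) x≢k₁

  <k₀⇒<k₁ : ∀ {x : Fin (suc m)} → x < k₀ → x < k₁
  <k₀⇒<k₁ x<k₀ = Fin.<-trans x<k₀ k₀<k₁

  k₁<⇒k₀< : ∀ {x : Fin (suc m)} → k₁ < x → k₀ < x
  k₁<⇒k₀< = Fin.<-trans k₀<k₁

  data Position (x : Fin (suc m)) : Set where
    at-k₀     : x ≡ k₀ → Position x
    at-k₁     : x ≡ k₁ → Position x
    elsewhere : x ≢ k₀ → x ≢ k₁ → Position x

  position : ∀ x → Position x
  position x with x Fin.≟ k₀ | x Fin.≟ k₁
  ... | yes x≡k₀ | _        = at-k₀ x≡k₀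
  ... | no _     | yes x≡k₁ = at-k₁ x≡k₁
  ... | no x≢k₀  | no x≢k₁  = elsewhere x≢k₀ x≢k₁

  σ : Fin (suc m) → Fin (suc m)
  σ = PC.transpose k₀ k₁

  σ-k₀ : σ k₀ ≡ k₁
  σ-k₀ = transpose-matchˡ k₀ k₁

  σ-k₁ : σ k₁ ≡ k₀
  σ-k₁ = transpose-matchʳ k₀ k₁ k₀≢k₁

  σ-other : ∀ x → x ≢ k₀ → x ≢ k₁ → σ x ≡ x
  σ-other = transpose-other k₀ k₁

  σ-involutive : ∀ x → σ (σ x) ≡ x
  σ-involutive x with position x
  ... | at-k₀ refl rewrite σ-k₀ = σ-k₁
  ... | at-k₁ refl rewrite σ-k₁ = σ-k₀
  ... | elsewhere x≢k₀ x≢k₁ rewrite σ-other x x≢k₀ x≢k₁ = σ-other x x≢k₀ x≢k₁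

  σ-injective : ∀ {x y} → σ x ≡ σ y → x ≡ y
  σ-injective {x} {y} e = trans (sym (σ-involutive x)) (trans (cong σ e) (σ-involutive y))

  s-inverse : ∀ x → s k ⟨$⟩ˡ x ≡ σ x
  s-inverse x with position x
  ... | at-k₀ refl = trans (transpose-matchʳ k₁ k₀ (λ e → k₀≢k₁ (sym e))) (sym σ-k₀)
  ... | at-k₁ refl = trans (transpose-matchˡ k₁ k₀) (sym σ-k₁)
  ... | elsewhere x≢k₀ x≢k₁ = trans (transpose-other k₁ k₀ x x≢k₁ x≢k₀) (sym (σ-other x x≢k₀ x≢k₁))

  σ-monotone : ∀ {a b : Fin (suc m)} → a < b → (a ≡ k₀ → b ≡ k₁ → ⊥) → σ a < σ b
  σ-monotone {a} {b} a<b not-k₀k₁ with position a | position b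
  ... | at-k₀ refl | at-k₀ refl = ⊥-elim (Fin.<-irrefl refl a<b)
  ... | at-k₀ refl | at-k₁ refl = ⊥-elim (not-k₀k₁ refl refl)
  ... | at-k₀ refl | elsewhere b≢k₀ b≢k₁ rewrite σ-k₀ | σ-other b b≢k₀ b≢k₁ = k₀<⇒k₁< a<b b≢k₁
  ... | at-k₁ refl | at-k₀ refl = ⊥-elim (Fin.<-asym a<b k₀<k₁)
  ... | at-k₁ refl | at-k₁ refl = ⊥-elim (Fin.<-irrefl refl a<b)
  ... | at-k₁ refl | elsewhere b≢k₀ b≢k₁ rewrite σ-k₁ | σ-other b b≢k₀ b≢k₁ = k₁<⇒k₀< a<b
  ... | elsewhere a≢k₀ a≢k₁ | at-k₀ refl rewrite σ-k₀ | σ-other a a≢k₀ a≢k₁ = <k₀⇒<k₁ a<b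
  ... | elsewhere a≢k₀ a≢k₁ | at-k₁ refl rewrite σ-k₁ | σ-other a a≢k₀ a≢k₁ = <k₁⇒<k₀ a<b a≢k₀
  ... | elsewhere a≢k₀ a≢k₁ | elsewhere b≢k₀ b≢k₁
      rewrite σ-other a a≢k₀ a≢k₁ | σ-other b b≢k₀ b≢k₁ = a<b

  σ-reflects : ∀ {a b : Fin (suc m)} → σ a < σ b → (a ≡ k₁ → b ≡ k₀ → ⊥) → a < b
  σ-reflects {a} {b} σa<σb not-k₁k₀ = subst₂ _<_ (σ-involutive a) (σ-involutive b)
    (σ-monotone σa<σb (λ σa≡k₀ σb≡k₁ →
      not-k₁k₀ (σ-injective (trans σa≡k₀ (sym σ-k₁))) (σ-injective (trans σb≡k₁ (sym σ-k₀)))))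

-- The criterion for W(π)

-- Conditions (1)–(3) for f = π and p = w⁻¹.
record WCriterion {n : ℕ} (f p : Fin n → Fin n) : Set where
  field
    involutive          : ∀ x → f (f x) ≡ x
    cycle-reversed      : ∀ a → a < f a → p (f a) < p a
    cycle-uninterrupted : ∀ a c → a < c → c < f a → p (f a) < p c → p c < p a → ⊥
    cycles-ordered      : ∀ a b → a ≤ f a → b ≤ f b → a < b → f a < f b → p a < p (f b)

WCriterion-cong : {f p f′ p′ : Fin n → Fin n} → (∀ x → f x ≡ f′ x) → (∀ x → p x ≡ p′ x) →
                  WCriterion f p → WCriterion f′ p′
WCriterion-cong {f = f} {p} {f′} {p′} f≗f′ p≗p′ C = record
  { involutive = λ x → trans (sym (f≗f′ (f′ x))) (trans (cong f (sym (f≗f′ x))) (involutive x))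
  ; cycle-reversed = λ a a<fa → subst₂ _<_ (pf≗p′f′ a) (p≗p′ a) (cycle-reversed a (subst (a <_) (sym (f≗f′ a)) a<fa))
  ; cycle-uninterrupted = λ a c a<c c<fa pfa<pc pc<pa → cycle-uninterrupted a c a<c (subst (c <_) (sym (f≗f′ a)) c<fa)
      (subst₂ _<_ (sym (pf≗p′f′ a)) (sym (p≗p′ c)) pfa<pc) (subst₂ _<_ (sym (p≗p′ c)) (sym (p≗p′ a)) pc<pa)
  ; cycles-ordered = λ a b a≤fa b≤fb a<b fa<fb → subst₂ _<_ (p≗p′ a) (pf≗p′f′ b)
      (cycles-ordered a b (subst (a ≤_) (sym (f≗f′ a)) a≤fa) (subst (b ≤_) (sym (f≗f′ b)) b≤fb) a<b
        (subst₂ _<_ (sym (f≗f′ a)) (sym (f≗f′ b)) fa<fb))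
  }
  where
  open WCriterion C
  pf≗p′f′ : ∀ x → p (f x) ≡ p′ (f′ x)
  pf≗p′f′ x = trans (p≗p′ (f x)) (cong p′ (f≗f′ x))

WCriterion-id : WCriterion {n} (λ x → x) (λ x → x)
WCriterion-id = record
  { involutive = λ x → refl
  ; cycle-reversed = λ a a<a → ⊥-elim (Fin.<-irrefl refl a<a)
  ; cycle-uninterrupted = λ a c a<c c<a _ _ → Fin.<-asym a<c c<a
  ; cycles-ordered = λ a b _ _ a<b _ → a<b
  }

module WCriterionProperties {f p : Fin n → Fin n} (C : WCriterion f p) where
  open WCriterion C

  f-injective : ∀ {x y} → f x ≡ f y → x ≡ y
  f-injective {x} {y} e = trans (sym (involutive x)) (trans (cong f e) (involutive y))

  f-flip : ∀ {x y} → f x ≡ y → x ≡ f y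
  f-flip {x} e = trans (sym (involutive x)) (cong f e)

  flipped-ascending : ∀ {z} → f z < z → f z ≤ f (f z)
  flipped-ascending {z} fz<z = ℕ.<⇒≤ (subst (f z <_) (sym (involutive z)) fz<z)

  InCycle : Fin n → Fin n → Set
  InCycle z x = x ≡ z ⊎ x ≡ f z

  in-flipped-cycle : ∀ {x z} → InCycle z x → InCycle (f z) x
  in-flipped-cycle {z = z} (inj₁ x≡z) = inj₂ (trans x≡z (sym (involutive z)))
  in-flipped-cycle (inj₂ x≡fz) = inj₁ x≡fz

  larger-first : ∀ {a x} → a ≤ f a → InCycle a x → p x ≤ p a
  larger-first a≤fa (inj₁ refl) = Fin.≤-refl
  larger-first {a} a≤fa (inj₂ refl) with ≤⇒<⊎≡ a≤fa
  ... | inj₁ a<fa = ℕ.<⇒≤ (cycle-reversed a a<fa)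
  ... | inj₂ a≡fa = Fin.≤-reflexive (cong p (sym a≡fa))

  smaller-last : ∀ {b y} → b ≤ f b → InCycle b y → p (f b) ≤ p y
  smaller-last b≤fb (inj₂ refl) = Fin.≤-refl
  smaller-last {b} b≤fb (inj₁ refl) with ≤⇒<⊎≡ b≤fb
  ... | inj₁ b<fb = ℕ.<⇒≤ (cycle-reversed b b<fb)
  ... | inj₂ b≡fb = Fin.≤-reflexive (cong p (sym b≡fb))

  cycle-before-cycle : ∀ {a b x y} → a ≤ f a → b ≤ f b → a < b → f a < f b →
                       InCycle a x → InCycle b y → p x < p y
  cycle-before-cycle {a} {b} a≤fa b≤fb a<b fa<fb x∈a y∈b =
    ℕ.≤-<-trans (larger-first a≤fa x∈a) (ℕ.<-≤-trans (cycles-ordered a b a≤fa b≤fb a<b fa<fb) (smaller-last b≤fb y∈b))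

  p-id⇒f-id : (∀ x → p x ≡ x) → ∀ x → f x ≡ x
  p-id⇒f-id p≗id x with Fin.<-cmp x (f x)
  ... | tri< x<fx _ _ = ⊥-elim (Fin.<-asym x<fx (subst₂ _<_ (p≗id (f x)) (p≗id x) (cycle-reversed x x<fx)))
  ... | tri≈ _ x≡fx _ = sym x≡fx
  ... | tri> _ _ fx<x = ⊥-elim (Fin.<-asym fx<x (subst₂ _<_ (trans (cong p (involutive x)) (p≗id x)) (p≗id (f x))
          (cycle-reversed (f x) (subst (f x <_) (sym (involutive x)) fx<x))))

module CriterionSteps {m : ℕ} (k : Fin m) where
  open Adjacent k

  module _ {f p : Fin (suc m) → Fin (suc m)} (C : WCriterion f p) where
    open WCriterion C
    open WCriterionProperties C

    cycle-k₀-before-cycle-k₁ : f k₀ < f k₁ → f k₀ ≢ k₁ →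
                               ∀ {x y} → InCycle k₀ x → InCycle k₁ y → p x < p y
    cycle-k₀-before-cycle-k₁ fk₀<fk₁ fk₀≢k₁ x∈ y∈ with ≤⊎> k₀ (f k₀) | ≤⊎> k₁ (f k₁)
    ... | inj₁ k₀≤fk₀ | inj₁ k₁≤fk₁ = cycle-before-cycle k₀≤fk₀ k₁≤fk₁ k₀<k₁ fk₀<fk₁ x∈ y∈
    ... | inj₁ k₀≤fk₀ | inj₂ fk₁<k₁ =
          ⊥-elim (Fin.<-irrefl refl (ℕ.≤-<-trans k₀≤fk₀ (Fin.<-trans fk₀<fk₁ (<k₁⇒<k₀ fk₁<k₁ fk₁≢k₀))))
      where
      fk₁≢k₀ : f k₁ ≢ k₀
      fk₁≢k₀ e = fk₀≢k₁ (sym (f-flip e))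
    ... | inj₂ fk₀<k₀ | inj₁ k₁≤fk₁ =
          cycle-before-cycle (flipped-ascending fk₀<k₀) k₁≤fk₁ (Fin.<-trans fk₀<k₀ k₀<k₁)
            (subst (_< f k₁) (sym (involutive k₀)) (ℕ.<-≤-trans k₀<k₁ k₁≤fk₁)) (in-flipped-cycle x∈) y∈
    ... | inj₂ fk₀<k₀ | inj₂ fk₁<k₁ =
          cycle-before-cycle (flipped-ascending fk₀<k₀) (flipped-ascending fk₁<k₁) fk₀<fk₁
            (subst₂ _<_ (sym (involutive k₀)) (sym (involutive k₁)) k₀<k₁) (in-flipped-cycle x∈) (in-flipped-cycle y∈)

    uninterrupted-away-from-k : ∀ a c → a ≢ k₀ → f a ≢ k₁ → a < c → c < f a →
                                p (f a) < p (σ c) → p (σ c) < p a → ⊥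
    uninterrupted-away-from-k a c a≢k₀ fa≢k₁ a<c c<fa pfa<pσc pσc<pa with position c
    ... | at-k₀ refl rewrite σ-k₀ =
          cycle-uninterrupted a k₁ (<k₀⇒<k₁ a<c) (k₀<⇒k₁< c<fa fa≢k₁) pfa<pσc pσc<pa
    ... | at-k₁ refl rewrite σ-k₁ =
          cycle-uninterrupted a k₀ (<k₁⇒<k₀ a<c a≢k₀) (k₁<⇒k₀< c<fa) pfa<pσc pσc<pa
    ... | elsewhere c≢k₀ c≢k₁ rewrite σ-other c c≢k₀ c≢k₁ =
          cycle-uninterrupted a c a<c c<fa pfa<pσc pσc<pa

    ascent-at-fixed-pair : f k₀ ≡ k₀ → f k₁ ≡ k₁ → p k₀ < p k₁ →
                           WCriterion (λ x → σ (f x)) (λ x → p (σ x))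
    ascent-at-fixed-pair fk₀ fk₁ ascent = record
      { involutive = involutive′ ; cycle-reversed = reversed′
      ; cycle-uninterrupted = uninterrupted′ ; cycles-ordered = ordered′ }
      where
      f-elsewhere : ∀ {x} → x ≢ k₀ → x ≢ k₁ → (f x ≢ k₀) × (f x ≢ k₁)
      f-elsewhere x≢k₀ x≢k₁ = (λ e → x≢k₀ (trans (f-flip e) fk₀)) , (λ e → x≢k₁ (trans (f-flip e) fk₁))
      σf-elsewhere : ∀ {x} → x ≢ k₀ → x ≢ k₁ → σ (f x) ≡ f x
      σf-elsewhere {x} x≢k₀ x≢k₁ = σ-other (f x) (proj₁ (f-elsewhere x≢k₀ x≢k₁)) (proj₂ (f-elsewhere x≢k₀ x≢k₁))
      involutive′ : ∀ x → σ (f (σ (f x))) ≡ x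
      involutive′ x with position x
      ... | at-k₀ refl rewrite fk₀ | σ-k₀ | fk₁ = σ-k₁
      ... | at-k₁ refl rewrite fk₁ | σ-k₁ | fk₀ = σ-k₀
      ... | elsewhere x≢k₀ x≢k₁ rewrite σf-elsewhere x≢k₀ x≢k₁ | involutive x = σ-other x x≢k₀ x≢k₁
      reversed′ : ∀ a → a < σ (f a) → p (σ (σ (f a))) < p (σ a)
      reversed′ a a<σfa with position a
      ... | at-k₀ refl rewrite fk₀ | σ-k₀ | σ-k₁ = ascent
      ... | at-k₁ refl rewrite fk₁ | σ-k₁ = ⊥-elim (Fin.<-asym a<σfa k₀<k₁)
      ... | elsewhere a≢k₀ a≢k₁ rewrite σf-elsewhere a≢k₀ a≢k₁ | σf-elsewhere a≢k₀ a≢k₁ | σ-other a a≢k₀ a≢k₁ =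
            cycle-reversed a a<σfa
      uninterrupted′ : ∀ a c → a < c → c < σ (f a) → p (σ (σ (f a))) < p (σ c) → p (σ c) < p (σ a) → ⊥
      uninterrupted′ a c a<c c<σfa l₁ l₂ with position a
      ... | at-k₀ refl rewrite fk₀ | σ-k₀ = nothing-between c a<c c<σfa
      ... | at-k₁ refl rewrite fk₁ | σ-k₁ = Fin.<-asym k₀<k₁ (Fin.<-trans a<c c<σfa)
      ... | elsewhere a≢k₀ a≢k₁ rewrite σf-elsewhere a≢k₀ a≢k₁ | σf-elsewhere a≢k₀ a≢k₁ | σ-other a a≢k₀ a≢k₁ =
            uninterrupted-away-from-k a c a≢k₀ (proj₂ (f-elsewhere a≢k₀ a≢k₁)) a<c c<σfa l₁ l₂
      ordered′ : ∀ a b → a ≤ σ (f a) → b ≤ σ (f b) → a < b → σ (f a) < σ (f b) → p (σ a) < p (σ (σ (f b)))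
      ordered′ a b a≤ b≤ a<b fa<fb with position a | position b
      ... | at-k₀ refl | at-k₀ refl = ⊥-elim (Fin.<-irrefl refl a<b)
      ... | at-k₀ refl | at-k₁ refl rewrite fk₁ | σ-k₁ = ⊥-elim (ℕ.<⇒≱ k₀<k₁ b≤)
      ... | at-k₀ refl | elsewhere b≢k₀ b≢k₁ rewrite σf-elsewhere b≢k₀ b≢k₁ | σf-elsewhere b≢k₀ b≢k₁ | fk₀ | σ-k₀ =
            cycles-ordered k₁ b (Fin.≤-reflexive (sym fk₁)) b≤ (k₀<⇒k₁< a<b b≢k₁) (subst (_< f b) (sym fk₁) fa<fb)
      ... | at-k₁ refl | _ rewrite fk₁ | σ-k₁ = ⊥-elim (ℕ.<⇒≱ k₀<k₁ a≤)
      ... | elsewhere _ _ | at-k₁ refl rewrite fk₁ | σ-k₁ = ⊥-elim (ℕ.<⇒≱ k₀<k₁ b≤)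
      ... | elsewhere a≢k₀ a≢k₁ | at-k₀ b≡k₀ =
            subst₂ _<_ (cong p (sym (σ-other a a≢k₀ a≢k₁))) (cong p (sym (σ-involutive (f b))))
              (cycles-ordered a b (subst (a ≤_) (σf-elsewhere a≢k₀ a≢k₁) a≤) (Fin.≤-reflexive (sym fb≡b)) a<b
                (subst (f a <_) (sym fb≡b) (subst (f a <_) (sym b≡k₀)
                  (<k₁⇒<k₀ (subst₂ _<_ (σf-elsewhere a≢k₀ a≢k₁) (trans (cong σ (trans (cong f b≡k₀) fk₀)) σ-k₀) fa<fb)
                           (proj₁ (f-elsewhere a≢k₀ a≢k₁))))))
        where
        fb≡b : f b ≡ b
        fb≡b = trans (cong f b≡k₀) (trans fk₀ (sym b≡k₀))
      ... | elsewhere a≢k₀ a≢k₁ | elsewhere b≢k₀ b≢k₁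
          rewrite σf-elsewhere a≢k₀ a≢k₁ | σf-elsewhere b≢k₀ b≢k₁ | σf-elsewhere b≢k₀ b≢k₁ | σ-other a a≢k₀ a≢k₁ =
            cycles-ordered a b a≤ b≤ a<b fa<fb

    -- Conjugating by σ only disturbs the conditions on the pair (k₀, k₁), so the
    -- criterion transfers as soon as these four instances hold.
    module Conjugation (fk₀≢k₁ : f k₀ ≢ k₁)
      (uninterrupted-k₁ : p (f k₁) < p k₀ → p k₀ < p k₁ → ⊥)
      (uninterrupted-k₀ : p k₀ < p k₁ → p k₁ < p (f k₀) → ⊥)
      (ordered-ascending : k₁ ≤ f k₁ → k₀ ≤ f k₀ → σ (f k₁) < σ (f k₀) → p k₁ < p (f k₀))
      (ordered-descending : f k₁ ≤ k₁ → f k₀ ≤ k₀ → σ (f k₁) < σ (f k₀) → p (f k₁) < p k₀) where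

      not-k₁↦k₀ : ∀ {x} → x ≡ k₁ → f x ≡ k₀ → ⊥
      not-k₁↦k₀ refl fk₁≡k₀ = fk₀≢k₁ (sym (f-flip fk₁≡k₀))

      ≤-from-σ : ∀ x → σ x ≤ σ (f x) → x ≤ f x
      ≤-from-σ x σx≤σfx with ≤⇒<⊎≡ σx≤σfx
      ... | inj₁ σx<σfx = ℕ.<⇒≤ (σ-reflects σx<σfx not-k₁↦k₀)
      ... | inj₂ σx≡σfx = Fin.≤-reflexive (σ-injective σx≡σfx)

      uninterrupted-σ : ∀ x z → σ x < σ z → σ z < σ (f x) → p (f x) < p z → p z < p x → ⊥
      uninterrupted-σ x z l₁ l₂ l₃ l₄ with both-or-not (x Fin.≟ k₁) (z Fin.≟ k₀)
      ... | inj₁ (refl , refl) = uninterrupted-k₁ l₃ l₄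
      ... | inj₂ not-k₁k₀ with both-or-not (z Fin.≟ k₁) (f x Fin.≟ k₀)
      ...   | inj₁ (refl , fx≡k₀) =
              uninterrupted-k₀ (subst (_< p k₁) (cong p fx≡k₀) l₃) (subst (p k₁ <_) (cong p (f-flip fx≡k₀)) l₄)
      ...   | inj₂ not-k₁k₀′ = cycle-uninterrupted x z (σ-reflects l₁ not-k₁k₀) (σ-reflects l₂ not-k₁k₀′) l₃ l₄

      ordered-σ : ∀ x y → σ x ≤ σ (f x) → σ y ≤ σ (f y) → σ x < σ y → σ (f x) < σ (f y) → p x < p (f y)
      ordered-σ x y x≤ y≤ x<y fx<fy with both-or-not (x Fin.≟ k₁) (y Fin.≟ k₀)
      ... | inj₁ (refl , refl) = ordered-ascending (≤-from-σ k₁ x≤) (≤-from-σ k₀ y≤) fx<fy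
      ... | inj₂ not-k₁k₀ with both-or-not (f x Fin.≟ k₁) (f y Fin.≟ k₀)
      ...   | inj₁ (fx≡k₁ , fy≡k₀) =
              subst₂ _<_ (cong p (sym (f-flip fx≡k₁))) (cong p (sym fy≡k₀))
                (ordered-descending (subst (_≤ k₁) (f-flip fx≡k₁) (subst (x ≤_) fx≡k₁ (≤-from-σ x x≤)))
                                    (subst (_≤ k₀) (f-flip fy≡k₀) (subst (y ≤_) fy≡k₀ (≤-from-σ y y≤)))
                                    (subst₂ _<_ (cong σ (f-flip fx≡k₁)) (cong σ (f-flip fy≡k₀)) x<y))
      ...   | inj₂ not-k₁k₀′ =
              cycles-ordered x y (≤-from-σ x x≤) (≤-from-σ y y≤) (σ-reflects x<y not-k₁k₀) (σ-reflects fx<fy not-k₁k₀′)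

      criterion : WCriterion (λ x → σ (f (σ x))) (λ x → p (σ x))
      criterion = record
        { involutive = involutive′ ; cycle-reversed = reversed′
        ; cycle-uninterrupted = uninterrupted′ ; cycles-ordered = ordered′ }
        where
        involutive′ : ∀ x → σ (f (σ (σ (f (σ x))))) ≡ x
        involutive′ x rewrite σ-involutive (f (σ x)) | involutive (σ x) = σ-involutive x
        reversed′ : ∀ a → a < σ (f (σ a)) → p (σ (σ (f (σ a)))) < p (σ a)
        reversed′ a a< = subst (_< p (σ a)) (cong p (sym (σ-involutive (f (σ a)))))
          (cycle-reversed (σ a) (σ-reflects (subst (_< σ (f (σ a))) (sym (σ-involutive a)) a<) not-k₁↦k₀))
        uninterrupted′ : ∀ a c → a < c → c < σ (f (σ a)) → p (σ (σ (f (σ a)))) < p (σ c) → p (σ c) < p (σ a) → ⊥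
        uninterrupted′ a c a<c c< l₁ l₂ =
          uninterrupted-σ (σ a) (σ c) (subst₂ _<_ (sym (σ-involutive a)) (sym (σ-involutive c)) a<c)
            (subst (_< σ (f (σ a))) (sym (σ-involutive c)) c<) (subst (_< p (σ c)) (cong p (σ-involutive (f (σ a)))) l₁) l₂
        ordered′ : ∀ a b → a ≤ σ (f (σ a)) → b ≤ σ (f (σ b)) → a < b → σ (f (σ a)) < σ (f (σ b)) →
                   p (σ a) < p (σ (σ (f (σ b))))
        ordered′ a b a≤ b≤ a<b fa<fb = subst (p (σ a) <_) (cong p (sym (σ-involutive (f (σ b)))))
          (ordered-σ (σ a) (σ b) (subst (_≤ σ (f (σ a))) (sym (σ-involutive a)) a≤) (subst (_≤ σ (f (σ b))) (sym (σ-involutive b)) b≤)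
            (subst₂ _<_ (sym (σ-involutive a)) (sym (σ-involutive b)) a<b) fa<fb)

    ascent-conjugate : p k₀ < p k₁ → f k₀ < f k₁ → (f k₀ ≡ k₀ → f k₁ ≡ k₁ → ⊥) →
                       WCriterion (λ x → σ (f (σ x))) (λ x → p (σ x))
    ascent-conjugate ascent fk₀<fk₁ not-fixed =
      Conjugation.criterion fk₀≢k₁
        (λ l _ → Fin.<-asym l (cycle-k₀-before-cycle-k₁ fk₀<fk₁ fk₀≢k₁ (inj₁ refl) (inj₂ refl)))
        (λ _ l → Fin.<-asym l (cycle-k₀-before-cycle-k₁ fk₀<fk₁ fk₀≢k₁ (inj₂ refl) (inj₁ refl)))
        (λ _ _ l → ⊥-elim (Fin.<-asym l (σ-monotone fk₀<fk₁ not-fixed)))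
        (λ _ _ l → ⊥-elim (Fin.<-asym fk₀<fk₁ (σ-reflects l (λ e₁ e₀ → not-fixed e₀ e₁))))
      where
      fk₀≢k₁ : f k₀ ≢ k₁
      fk₀≢k₁ e = Fin.<-asym k₀<k₁ (subst₂ _<_ e (sym (f-flip e)) fk₀<fk₁)

    descent-reverses-f : p k₁ < p k₀ → f k₁ < f k₀
    descent-reverses-f descent with Fin.<-cmp (f k₀) (f k₁)
    ... | tri≈ _ fk₀≡fk₁ _ = ⊥-elim (k₀≢k₁ (f-injective fk₀≡fk₁))
    ... | tri> _ _ fk₁<fk₀ = fk₁<fk₀
    ... | tri< fk₀<fk₁ _ _ with f k₀ Fin.≟ k₁
    ...   | yes fk₀≡k₁ = ⊥-elim (Fin.<-asym k₀<k₁ (subst₂ _<_ fk₀≡k₁ (sym (f-flip fk₀≡k₁)) fk₀<fk₁))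
    ...   | no fk₀≢k₁ =
            ⊥-elim (Fin.<-asym descent (cycle-k₀-before-cycle-k₁ fk₀<fk₁ fk₀≢k₁ (inj₁ refl) (inj₁ refl)))

    descent-conjugate : (∀ {x y} → p x ≡ p y → x ≡ y) → p k₁ < p k₀ → f k₀ ≢ k₁ →
                        WCriterion (λ x → σ (f (σ x))) (λ x → p (σ x))
    descent-conjugate p-injective descent fk₀≢k₁ =
      Conjugation.criterion fk₀≢k₁ (λ _ l → Fin.<-asym l descent) (λ l _ → Fin.<-asym l descent)
        ordered-ascending ordered-descending
      where
      fk₁<fk₀ : f k₁ < f k₀
      fk₁<fk₀ = descent-reverses-f descent
      ordered-ascending : k₁ ≤ f k₁ → k₀ ≤ f k₀ → σ (f k₁) < σ (f k₀) → p k₁ < p (f k₀)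
      ordered-ascending k₁≤fk₁ _ _ with Fin.<-cmp (p k₁) (p (f k₀))
      ... | tri< l _ _ = l
      ... | tri≈ _ e _ = ⊥-elim (Fin.<⇒≢ (ℕ.≤-<-trans k₁≤fk₁ fk₁<fk₀) (p-injective e))
      ... | tri> _ _ l = ⊥-elim (cycle-uninterrupted k₀ k₁ k₀<k₁ (ℕ.≤-<-trans k₁≤fk₁ fk₁<fk₀) l descent)
      ordered-descending : f k₁ ≤ k₁ → f k₀ ≤ k₀ → σ (f k₁) < σ (f k₀) → p (f k₁) < p k₀
      ordered-descending _ fk₀≤k₀ _ with Fin.<-cmp (p (f k₁)) (p k₀)
      ... | tri< l _ _ = l
      ... | tri≈ _ e _ = ⊥-elim (Fin.<⇒≢ (ℕ.<-≤-trans fk₁<fk₀ fk₀≤k₀) (p-injective e))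
      ... | tri> _ _ l = ⊥-elim (cycle-uninterrupted (f k₁) k₀ (ℕ.<-≤-trans fk₁<fk₀ fk₀≤k₀)
                                   (subst (k₀ <_) (sym (involutive k₁)) k₀<k₁)
                                   (subst (_< p k₀) (cong p (sym (involutive k₁))) descent) l)

    descent-at-swapped-pair : p k₁ < p k₀ → f k₀ ≡ k₁ → WCriterion (λ x → σ (f x)) (λ x → p (σ x))
    descent-at-swapped-pair descent fk₀ = record
      { involutive = involutive′ ; cycle-reversed = reversed′
      ; cycle-uninterrupted = uninterrupted′ ; cycles-ordered = ordered′ }
      where
      fk₁ : f k₁ ≡ k₀
      fk₁ = sym (f-flip fk₀)
      f-elsewhere : ∀ {x} → x ≢ k₀ → x ≢ k₁ → (f x ≢ k₀) × (f x ≢ k₁)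
      f-elsewhere x≢k₀ x≢k₁ = (λ e → x≢k₁ (trans (f-flip e) fk₀)) , (λ e → x≢k₀ (trans (f-flip e) fk₁))
      σf-elsewhere : ∀ {x} → x ≢ k₀ → x ≢ k₁ → σ (f x) ≡ f x
      σf-elsewhere {x} x≢k₀ x≢k₁ = σ-other (f x) (proj₁ (f-elsewhere x≢k₀ x≢k₁)) (proj₂ (f-elsewhere x≢k₀ x≢k₁))
      k₀≤fk₀ : k₀ ≤ f k₀
      k₀≤fk₀ = ℕ.<⇒≤ (subst (k₀ <_) (sym fk₀) k₀<k₁)
      σfk₀ : σ (f k₀) ≡ k₀
      σfk₀ = trans (cong σ fk₀) σ-k₁
      σfk₁ : σ (f k₁) ≡ k₁
      σfk₁ = trans (cong σ fk₁) σ-k₀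
      involutive′ : ∀ x → σ (f (σ (f x))) ≡ x
      involutive′ x with position x
      ... | at-k₀ refl rewrite σfk₀ = σfk₀
      ... | at-k₁ refl rewrite σfk₁ = σfk₁
      ... | elsewhere x≢k₀ x≢k₁ rewrite σf-elsewhere x≢k₀ x≢k₁ | involutive x = σ-other x x≢k₀ x≢k₁
      reversed′ : ∀ a → a < σ (f a) → p (σ (σ (f a))) < p (σ a)
      reversed′ a a<σfa with position a
      ... | at-k₀ refl = ⊥-elim (Fin.<-irrefl refl (subst (k₀ <_) σfk₀ a<σfa))
      ... | at-k₁ refl = ⊥-elim (Fin.<-irrefl refl (subst (k₁ <_) σfk₁ a<σfa))
      ... | elsewhere a≢k₀ a≢k₁ rewrite σf-elsewhere a≢k₀ a≢k₁ | σf-elsewhere a≢k₀ a≢k₁ | σ-other a a≢k₀ a≢k₁ =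
            cycle-reversed a a<σfa
      uninterrupted′ : ∀ a c → a < c → c < σ (f a) → p (σ (σ (f a))) < p (σ c) → p (σ c) < p (σ a) → ⊥
      uninterrupted′ a c a<c c<σfa l₁ l₂ with position a
      ... | at-k₀ refl = Fin.<-asym a<c (subst (c <_) σfk₀ c<σfa)
      ... | at-k₁ refl = Fin.<-asym a<c (subst (c <_) σfk₁ c<σfa)
      ... | elsewhere a≢k₀ a≢k₁ rewrite σf-elsewhere a≢k₀ a≢k₁ | σf-elsewhere a≢k₀ a≢k₁ | σ-other a a≢k₀ a≢k₁ =
            uninterrupted-away-from-k a c a≢k₀ (proj₂ (f-elsewhere a≢k₀ a≢k₁)) a<c c<σfa l₁ l₂
      ordered′ : ∀ a b → a ≤ σ (f a) → b ≤ σ (f b) → a < b → σ (f a) < σ (f b) → p (σ a) < p (σ (σ (f b)))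
      ordered′ a b a≤ b≤ a<b fa<fb with position a | position b
      ... | at-k₀ refl | at-k₀ refl = ⊥-elim (Fin.<-irrefl refl a<b)
      ... | at-k₁ refl | at-k₁ refl = ⊥-elim (Fin.<-irrefl refl a<b)
      ... | at-k₁ refl | at-k₀ refl = ⊥-elim (Fin.<-asym k₀<k₁ a<b)
      ... | at-k₀ refl | at-k₁ refl rewrite σfk₁ | σ-k₀ | σ-k₁ = descent
      ... | at-k₀ refl | elsewhere b≢k₀ b≢k₁ rewrite σf-elsewhere b≢k₀ b≢k₁ | σf-elsewhere b≢k₀ b≢k₁ | σ-k₀ =
            Fin.<-trans descent (cycles-ordered k₀ b k₀≤fk₀ b≤ a<b
              (subst (_< f b) (sym fk₀) (k₀<⇒k₁< (subst (_< f b) σfk₀ fa<fb) (proj₂ (f-elsewhere b≢k₀ b≢k₁)))))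
      ... | at-k₁ refl | elsewhere b≢k₀ b≢k₁ rewrite σf-elsewhere b≢k₀ b≢k₁ | σf-elsewhere b≢k₀ b≢k₁ | σ-k₁ =
            cycles-ordered k₀ b k₀≤fk₀ b≤ (Fin.<-trans k₀<k₁ a<b) (subst (_< f b) (sym fk₀) (subst (_< f b) σfk₁ fa<fb))
      ... | elsewhere a≢k₀ a≢k₁ | at-k₀ refl rewrite σf-elsewhere a≢k₀ a≢k₁ | σfk₀ | σ-k₀ | σ-other a a≢k₀ a≢k₁ =
            subst (p a <_) (cong p fk₀) (cycles-ordered a k₀ a≤ k₀≤fk₀ a<b (subst (f a <_) (sym fk₀) (<k₀⇒<k₁ fa<fb)))
      ... | elsewhere a≢k₀ a≢k₁ | at-k₁ refl rewrite σf-elsewhere a≢k₀ a≢k₁ | σfk₁ | σ-k₁ | σ-other a a≢k₀ a≢k₁ =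
            Fin.<-trans (subst (p a <_) (cong p fk₀) (cycles-ordered a k₀ a≤ k₀≤fk₀ (<k₁⇒<k₀ a<b a≢k₀)
                          (subst (f a <_) (sym fk₀) (<k₀⇒<k₁ (<k₁⇒<k₀ fa<fb (proj₁ (f-elsewhere a≢k₀ a≢k₁)))))))
                        descent
      ... | elsewhere a≢k₀ a≢k₁ | elsewhere b≢k₀ b≢k₁
          rewrite σf-elsewhere a≢k₀ a≢k₁ | σf-elsewhere b≢k₀ b≢k₁ | σf-elsewhere b≢k₀ b≢k₁ | σ-other a a≢k₀ a≢k₁ =
            cycles-ordered a b a≤ b≤ a<b fa<fb

-- Inversions and excedances

indicator : {A : Set} → Dec A → ℕ
indicator (yes _) = 1
indicator (no _)  = 0

indicator-cong : {A B : Set} → (A → B) → (B → A) → (a? : Dec A) (b? : Dec B) → indicator a? ≡ indicator b?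
indicator-cong A→B B→A (yes a) (yes b) = refl
indicator-cong A→B B→A (yes a) (no ¬b) = ⊥-elim (¬b (A→B a))
indicator-cong A→B B→A (no ¬a) (yes b) = ⊥-elim (¬a (B→A b))
indicator-cong A→B B→A (no ¬a) (no ¬b) = refl

indicator-yes : {A : Set} → A → (a? : Dec A) → indicator a? ≡ 1
indicator-yes a (yes _) = refl
indicator-yes a (no ¬a) = ⊥-elim (¬a a)

indicator-no : {A : Set} → ¬ A → (a? : Dec A) → indicator a? ≡ 0
indicator-no ¬a (yes a) = ⊥-elim (¬a a)
indicator-no ¬a (no _)  = refl

sum-zero : (f : Fin n → ℕ) → (∀ i → f i ≡ 0) → sum f ≡ 0
sum-zero {n} f f≗0 = trans (sum-cong-≗ f≗0) (sum-replicate-zero n)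

sum-agree-except : (f g : Fin n → ℕ) (i : Fin n) → (∀ j → j ≢ i → f j ≡ g j) → sum f + g i ≡ sum g + f i
sum-agree-except {suc n} f g i f≗g = begin
  sum f + g i                    ≡⟨ cong (_+ g i) (sum-remove f) ⟩
  f i + sum (f ∘ punchIn) + g i  ≡⟨ cong (λ r → f i + r + g i) (sum-cong-≗ λ j → f≗g _ (Fin.punchInᵢ≢i i j)) ⟩
  f i + sum (g ∘ punchIn) + g i  ≡⟨ swap-outer (f i) (sum (g ∘ punchIn)) (g i) ⟩
  g i + sum (g ∘ punchIn) + f i  ≡⟨ cong (_+ f i) (sym (sum-remove g)) ⟩
  sum g + f i                    ∎
  where
  open ≡-Reasoning
  open +-*-Solver
  punchIn : Fin n → Fin (suc n)
  punchIn = Fin.punchIn i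
  swap-outer : ∀ a r b → a + r + b ≡ b + r + a
  swap-outer = solve 3 (λ a r b → a :+ r :+ b := b :+ r :+ a) refl

sum-one-more : (f g : Fin n → ℕ) (i : Fin n) → (∀ j → j ≢ i → f j ≡ g j) → f i ≡ suc (g i) →
               sum f ≡ suc (sum g)
sum-one-more f g i f≗g fi = ℕ.+-cancelʳ-≡ (g i) _ _ (begin
  sum f + g i          ≡⟨ sum-agree-except f g i f≗g ⟩
  sum g + f i          ≡⟨ cong (sum g +_) fi ⟩
  sum g + suc (g i)    ≡⟨ ℕ.+-suc (sum g) (g i) ⟩
  suc (sum g) + g i    ∎)
  where open ≡-Reasoning

sum²-one-more : (F G : Fin n → Fin n → ℕ) (i₀ j₀ : Fin n) →
                (∀ i j → (i ≡ i₀ → j ≡ j₀ → ⊥) → F i j ≡ G i j) → F i₀ j₀ ≡ 1 → G i₀ j₀ ≡ 0 →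
                sum (λ i → sum (F i)) ≡ suc (sum (λ i → sum (G i)))
sum²-one-more F G i₀ j₀ F≗G F₀₀ G₀₀ =
  sum-one-more (λ i → sum (F i)) (λ i → sum (G i)) i₀
    (λ i i≢i₀ → sum-cong-≗ (λ j → F≗G i j (λ i≡i₀ _ → i≢i₀ i≡i₀)))
    (sum-one-more (F i₀) (G i₀) j₀ (λ j j≢j₀ → F≗G i₀ j (λ _ → j≢j₀)) (trans F₀₀ (cong suc (sym G₀₀))))

module _ {A : Set} {P : A → Set} (P? : Decidable P) where

  length-filter-++ : (xs ys : List A) → length (filter P? (xs ++ ys)) ≡ length (filter P? xs) + length (filter P? ys)
  length-filter-++ xs ys = trans (cong length (List.filter-++ P? xs ys)) (List.length-++ (filter P? xs))

  length-filter-map : {B : Set} (g : B → A) (xs : List B) →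
                      length (filter P? (map g xs)) ≡ length (filter (λ x → P? (g x)) xs)
  length-filter-map g [] = refl
  length-filter-map g (x ∷ xs) with P? (g x)
  ... | yes _ = cong suc (length-filter-map g xs)
  ... | no _  = length-filter-map g xs

  length-filter-tabulate : (g : Fin n → A) → length (filter P? (tabulate g)) ≡ sum (λ i → indicator (P? (g i)))
  length-filter-tabulate {zero} g = refl
  length-filter-tabulate {suc n} g with P? (g Fin.zero)
  ... | yes _ = cong suc (length-filter-tabulate (g ∘ Fin.suc))
  ... | no _  = length-filter-tabulate (g ∘ Fin.suc)

length-filter-cartesianProduct : {A B : Set} {P : A × B → Set} (P? : Decidable P) (g : Fin n → A) (ys : List B) →
  length (filter P? (cartesianProduct (tabulate g) ys)) ≡ sum (λ i → length (filter (λ y → P? (g i , y)) ys))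
length-filter-cartesianProduct {zero} P? g ys = refl
length-filter-cartesianProduct {suc n} P? g ys =
  trans (length-filter-++ P? (map (g Fin.zero ,_) ys) _)
        (cong₂ _+_ (length-filter-map P? (g Fin.zero ,_) ys) (length-filter-cartesianProduct P? (g ∘ Fin.suc) ys))

Inversion? : (w : Permutation′ n) (i j : Fin n) → Dec ((i < j) × (w ⟨$⟩ʳ j < w ⟨$⟩ʳ i))
Inversion? w i j = (i <? j) ×-dec (w ⟨$⟩ʳ j <? w ⟨$⟩ʳ i)

inversions : Permutation′ n → ℕ
inversions w = sum (λ i → sum (λ j → indicator (Inversion? w i j)))

ℓ≡inversions : (w : Permutation′ n) → ℓ w ≡ inversions w
ℓ≡inversions {n} w =
  trans (length-filter-cartesianProduct (λ (i , j) → Inversion? w i j) id (allFin n))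
        (sum-cong-≗ (λ i → length-filter-tabulate (Inversion? w i) id))

excedances : Permutation′ n → ℕ
excedances w = sum (λ i → indicator (i <? w ⟨$⟩ʳ i))

exc≡excedances : (w : Permutation′ n) → exc w ≡ excedances w
exc≡excedances w = length-filter-tabulate (λ a → a <? w ⟨$⟩ʳ a) id

⟨$⟩ˡ-cong : {u v : Permutation′ n} → u ≈ₚ v → ∀ x → u ⟨$⟩ˡ x ≡ v ⟨$⟩ˡ x
⟨$⟩ˡ-cong {u = u} {v} u≈v x = trans (cong (u ⟨$⟩ˡ_) (sym (trans (u≈v (v ⟨$⟩ˡ x)) (Perm.inverseʳ v)))) (Perm.inverseˡ u)

ℓ-cong : {u v : Permutation′ n} → u ≈ₚ v → ℓ u ≡ ℓ v
ℓ-cong {u = u} {v} u≈v = begin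
  ℓ u           ≡⟨ ℓ≡inversions u ⟩
  inversions u  ≡⟨ sum-cong-≗ (λ i → sum-cong-≗ (λ j → indicator-cong
                     (λ (i<j , l) → i<j , subst₂ _<_ (u≈v j) (u≈v i) l)
                     (λ (i<j , l) → i<j , subst₂ _<_ (sym (u≈v j)) (sym (u≈v i)) l)
                     (Inversion? u i j) (Inversion? v i j))) ⟩
  inversions v  ≡⟨ sym (ℓ≡inversions v) ⟩
  ℓ v           ∎
  where open ≡-Reasoning

exc-cong : {u v : Permutation′ n} → u ≈ₚ v → exc u ≡ exc v
exc-cong {u = u} {v} u≈v = begin
  exc u         ≡⟨ exc≡excedances u ⟩
  excedances u  ≡⟨ sum-cong-≗ (λ i → indicator-cong (subst (i <_) (u≈v i)) (subst (i <_) (sym (u≈v i)))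
                                                    (i <? u ⟨$⟩ʳ i) (i <? v ⟨$⟩ʳ i)) ⟩
  excedances v  ≡⟨ sym (exc≡excedances v) ⟩
  exc v         ∎
  where open ≡-Reasoning

ℓ₍ₙ₎-cong : {u v : Permutation′ n} → u ≈ₚ v → ℓ₍ₙ₎ u ≡ ℓ₍ₙ₎ v
ℓ₍ₙ₎-cong {u = u} {v} u≈v = cong (_/ 2) (cong₂ _+_ (ℓ-cong {u = u} {v} u≈v) (exc-cong {u = u} {v} u≈v))

ℓ₍ₙ₎-suc : {π π′ : Permutation′ n} → ℓ π′ + exc π′ ≡ 2 + (ℓ π + exc π) → ℓ₍ₙ₎ π′ ≡ suc (ℓ₍ₙ₎ π)
ℓ₍ₙ₎-suc {π = π} eq = trans (cong (_/ 2) eq) (m/n≡1+[m∸n]/n {2 + (ℓ π + exc π)} {2} (s≤s (s≤s z≤n)))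

ℓ-e : ℓ (e {n}) ≡ 0
ℓ-e {n} = trans (ℓ≡inversions (e {n}))
  (sum-zero {n} _ (λ i → sum-zero {n} _ (λ j → indicator-no (λ (i<j , j<i) → Fin.<-asym i<j j<i) (Inversion? (e {n}) i j))))

exc-e : exc (e {n}) ≡ 0
exc-e {n} = trans (exc≡excedances (e {n})) (sum-zero {n} _ (λ i → indicator-no (Fin.<-irrefl refl) (i <? i)))

ℓ₍ₙ₎-e : ℓ₍ₙ₎ (e {n}) ≡ 0
ℓ₍ₙ₎-e {n} rewrite ℓ-e {n} | exc-e {n} = refl

-- Reindexing the double sum by w⁻¹ × w⁻¹ turns inversions of w into inversions of w⁻¹.
ℓ-flip : (w : Permutation′ n) → ℓ (Perm.flip w) ≡ ℓ w
ℓ-flip {n} w = sym (begin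
  ℓ w
    ≡⟨ ℓ≡inversions w ⟩
  sum (λ i → sum (λ j → indicator (Inversion? w i j)))
    ≡⟨ sum-permute (λ i → sum (λ j → indicator (Inversion? w i j))) (Perm.flip w) ⟩
  sum (λ i → sum (λ j → indicator (Inversion? w (w⁻¹ i) j)))
    ≡⟨ sum-cong-≗ (λ i → sum-permute (λ j → indicator (Inversion? w (w⁻¹ i) j)) (Perm.flip w)) ⟩
  sum (λ i → sum (λ j → indicator (Inversion? w (w⁻¹ i) (w⁻¹ j))))
    ≡⟨ ∑-comm (λ i j → indicator (Inversion? w (w⁻¹ i) (w⁻¹ j))) ⟩
  sum (λ j → sum (λ i → indicator (Inversion? w (w⁻¹ i) (w⁻¹ j))))
    ≡⟨ sum-cong-≗ (λ j → sum-cong-≗ (λ i → indicator-cong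
         (λ (l₁ , l₂) → subst₂ _<_ (Perm.inverseʳ w) (Perm.inverseʳ w) l₂ , l₁)
         (λ (l₁ , l₂) → l₂ , subst₂ _<_ (sym (Perm.inverseʳ w)) (sym (Perm.inverseʳ w)) l₁)
         (Inversion? w (w⁻¹ i) (w⁻¹ j)) (Inversion? (Perm.flip w) j i))) ⟩
  sum (λ j → sum (λ i → indicator (Inversion? (Perm.flip w) j i)))
    ≡⟨ sym (ℓ≡inversions (Perm.flip w)) ⟩
  ℓ (Perm.flip w) ∎)
  where
  open ≡-Reasoning
  w⁻¹ : Fin n → Fin n
  w⁻¹ = w ⟨$⟩ˡ_

Involution : Permutation′ n → Set
Involution π = ∀ x → π ⟨$⟩ʳ (π ⟨$⟩ʳ x) ≡ x

involution-⟨$⟩ˡ : (π : Permutation′ n) → Involution π → ∀ x → π ⟨$⟩ˡ x ≡ π ⟨$⟩ʳ x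
involution-⟨$⟩ˡ π π² x = trans (cong (π ⟨$⟩ˡ_) (sym (π² x))) (Perm.inverseˡ π)

module LengthSteps {m : ℕ} (k : Fin m) where
  open Adjacent k

  s·-⟨$⟩ˡ : (w : Permutation′ (suc m)) → ∀ x → (s k · w) ⟨$⟩ˡ x ≡ w ⟨$⟩ˡ (σ x)
  s·-⟨$⟩ˡ w x = cong (w ⟨$⟩ˡ_) (s-inverse x)

  -- s_k w has exactly the inversions of w plus the pair of positions of k₀ and k₁.
  ℓ-ascent : (w : Permutation′ (suc m)) → w ⟨$⟩ˡ k₀ < w ⟨$⟩ˡ k₁ → ℓ (s k · w) ≡ suc (ℓ w)
  ℓ-ascent w ascent = begin
    ℓ (s k · w)           ≡⟨ ℓ≡inversions (s k · w) ⟩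
    inversions (s k · w)  ≡⟨ sum²-one-more F G i₀ j₀ F≗G F₀₀ G₀₀ ⟩
    suc (inversions w)    ≡⟨ cong suc (sym (ℓ≡inversions w)) ⟩
    suc (ℓ w)             ∎
    where
    open ≡-Reasoning
    i₀ j₀ : Fin (suc m)
    i₀ = w ⟨$⟩ˡ k₀
    j₀ = w ⟨$⟩ˡ k₁
    F G : Fin (suc m) → Fin (suc m) → ℕ
    F i j = indicator (Inversion? (s k · w) i j)
    G i j = indicator (Inversion? w i j)
    w-i₀ : w ⟨$⟩ʳ i₀ ≡ k₀
    w-i₀ = Perm.inverseʳ w
    w-j₀ : w ⟨$⟩ʳ j₀ ≡ k₁
    w-j₀ = Perm.inverseʳ w
    G₀₀ : G i₀ j₀ ≡ 0
    G₀₀ = indicator-no (λ (_ , l) → Fin.<-asym (subst₂ _<_ w-j₀ w-i₀ l) k₀<k₁) (Inversion? w i₀ j₀)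
    F₀₀ : F i₀ j₀ ≡ 1
    F₀₀ = indicator-yes (ascent , subst₂ _<_ (sym (trans (cong σ w-j₀) σ-k₁)) (sym (trans (cong σ w-i₀) σ-k₀)) k₀<k₁)
                        (Inversion? (s k · w) i₀ j₀)
    position-of : ∀ {i x} → w ⟨$⟩ʳ i ≡ x → i ≡ w ⟨$⟩ˡ x
    position-of e = trans (sym (Perm.inverseˡ w)) (cong (w ⟨$⟩ˡ_) e)
    F≗G : ∀ i j → (i ≡ i₀ → j ≡ j₀ → ⊥) → F i j ≡ G i j
    F≗G i j not-i₀j₀ = indicator-cong
      (λ (i<j , l) → i<j , σ-reflects l (λ e₁ e₀ → not-i₀j₀ (position-of e₀) (position-of e₁)))
      (λ (i<j , l) → i<j , σ-monotone l (λ e₁ e₀ → Fin.<-asym ascent (subst₂ _<_ (position-of e₀) (position-of e₁) i<j)))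
      (Inversion? (s k · w) i j) (Inversion? w i j)

  ℓ-descent : (w : Permutation′ (suc m)) → w ⟨$⟩ˡ k₁ < w ⟨$⟩ˡ k₀ → suc (ℓ (s k · w)) ≡ ℓ w
  ℓ-descent w descent =
    trans (sym (ℓ-ascent (s k · w) ascent′)) (ℓ-cong {u = s k · (s k · w)} {v = w} (λ x → σ-involutive (w ⟨$⟩ʳ x)))
    where
    ascent′ : (s k · w) ⟨$⟩ˡ k₀ < (s k · w) ⟨$⟩ˡ k₁
    ascent′ = subst₂ _<_ (sym (trans (s·-⟨$⟩ˡ w k₀) (cong (w ⟨$⟩ˡ_) σ-k₀)))
                         (sym (trans (s·-⟨$⟩ˡ w k₁) (cong (w ⟨$⟩ˡ_) σ-k₁))) descent

  ascent-or-descent : (w : Permutation′ (suc m)) → w ⟨$⟩ˡ k₀ < w ⟨$⟩ˡ k₁ ⊎ w ⟨$⟩ˡ k₁ < w ⟨$⟩ˡ k₀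
  ascent-or-descent w with Fin.<-cmp (w ⟨$⟩ˡ k₀) (w ⟨$⟩ˡ k₁)
  ... | tri< ascent _ _  = inj₁ ascent
  ... | tri≈ _ e _       = ⊥-elim (k₀≢k₁ (trans (sym (Perm.inverseʳ w)) (trans (cong (w ⟨$⟩ʳ_) e) (Perm.inverseʳ w))))
  ... | tri> _ _ descent = inj₂ descent

  exc-conjugate : (π : Permutation′ (suc m)) → π ⟨$⟩ʳ k₀ ≢ k₁ → π ⟨$⟩ʳ k₁ ≢ k₀ → exc ((s k · π) · s k) ≡ exc π
  exc-conjugate π πk₀≢k₁ πk₁≢k₀ = begin
    exc ((s k · π) · s k)                              ≡⟨ exc≡excedances ((s k · π) · s k) ⟩
    sum (λ i → indicator (i <? σ (π ⟨$⟩ʳ σ i)))         ≡⟨ sum-permute (λ i → indicator (i <? σ (π ⟨$⟩ʳ σ i))) (s k) ⟩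
    sum (λ i → indicator (σ i <? σ (π ⟨$⟩ʳ σ (σ i))))   ≡⟨ sum-cong-≗ (λ i → indicator-cong
         (λ l → σ-reflects (subst (σ i <_) (cong (λ z → σ (π ⟨$⟩ʳ z)) (σ-involutive i)) l) (λ { refl e → πk₁≢k₀ e }))
         (λ l → subst (σ i <_) (cong (λ z → σ (π ⟨$⟩ʳ z)) (sym (σ-involutive i))) (σ-monotone l (λ { refl e → πk₀≢k₁ e })))
         (σ i <? σ (π ⟨$⟩ʳ σ (σ i))) (i <? π ⟨$⟩ʳ i)) ⟩
    excedances π                                       ≡⟨ sym (exc≡excedances π) ⟩
    exc π                                              ∎
    where open ≡-Reasoning

  exc-fixed : (π : Permutation′ (suc m)) → π ⟨$⟩ʳ k₀ ≡ k₀ → π ⟨$⟩ʳ k₁ ≡ k₁ → exc (s k · π) ≡ suc (exc π)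
  exc-fixed π πk₀ πk₁ = begin
    exc (s k · π)            ≡⟨ exc≡excedances (s k · π) ⟩
    excedances (s k · π)     ≡⟨ sum-one-more F G k₀ F≗G (trans F-k₀ (cong suc (sym G-k₀))) ⟩
    suc (excedances π)       ≡⟨ cong suc (sym (exc≡excedances π)) ⟩
    suc (exc π)              ∎
    where
    open ≡-Reasoning
    F G : Fin (suc m) → ℕ
    F i = indicator (i <? σ (π ⟨$⟩ʳ i))
    G i = indicator (i <? π ⟨$⟩ʳ i)
    G-k₀ : G k₀ ≡ 0
    G-k₀ = indicator-no (λ l → Fin.<-irrefl refl (subst (k₀ <_) πk₀ l)) (k₀ <? π ⟨$⟩ʳ k₀)
    F-k₀ : F k₀ ≡ 1
    F-k₀ = indicator-yes (subst (k₀ <_) (sym (trans (cong σ πk₀) σ-k₀)) k₀<k₁) (k₀ <? σ (π ⟨$⟩ʳ k₀))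
    fixed-point-only : ∀ {i x} → π ⟨$⟩ʳ x ≡ x → π ⟨$⟩ʳ i ≡ x → i ≡ x
    fixed-point-only {i} {x} πx πi = trans (sym (Perm.inverseˡ π)) (trans (cong (π ⟨$⟩ˡ_) (trans πi (sym πx))) (Perm.inverseˡ π))
    F≗G : ∀ i → i ≢ k₀ → F i ≡ G i
    F≗G i i≢k₀ with position i
    ... | at-k₀ i≡k₀ = ⊥-elim (i≢k₀ i≡k₀)
    ... | at-k₁ refl = indicator-cong (λ l → ⊥-elim (Fin.<-asym k₀<k₁ (subst (k₁ <_) (trans (cong σ πk₁) σ-k₁) l)))
                                      (λ l → ⊥-elim (Fin.<-irrefl refl (subst (k₁ <_) πk₁ l))) _ _
    ... | elsewhere i≢k₀′ i≢k₁ = indicator-cong (subst (i <_) σπi) (subst (i <_) (sym σπi)) _ _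
      where
      σπi : σ (π ⟨$⟩ʳ i) ≡ π ⟨$⟩ʳ i
      σπi = σ-other _ (λ e → i≢k₀′ (fixed-point-only πk₀ e)) (λ e → i≢k₁ (fixed-point-only πk₁ e))

  ℓ₍ₙ₎-fixed : (π : Permutation′ (suc m)) → Involution π → π ⟨$⟩ʳ k₀ ≡ k₀ → π ⟨$⟩ʳ k₁ ≡ k₁ →
               ℓ₍ₙ₎ (s k · π) ≡ suc (ℓ₍ₙ₎ π)
  ℓ₍ₙ₎-fixed π π² πk₀ πk₁ = ℓ₍ₙ₎-suc {π = π} {s k · π} (begin
    ℓ (s k · π) + exc (s k · π)  ≡⟨ cong₂ _+_ (ℓ-ascent π ascent) (exc-fixed π πk₀ πk₁) ⟩
    suc (ℓ π) + suc (exc π)      ≡⟨ cong suc (ℕ.+-suc (ℓ π) (exc π)) ⟩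
    2 + (ℓ π + exc π)            ∎)
    where
    open ≡-Reasoning
    ascent : π ⟨$⟩ˡ k₀ < π ⟨$⟩ˡ k₁
    ascent = subst₂ _<_ (sym (trans (involution-⟨$⟩ˡ π π² k₀) πk₀)) (sym (trans (involution-⟨$⟩ˡ π π² k₁) πk₁)) k₀<k₁

  ℓ-conjugate : (π : Permutation′ (suc m)) → Involution π → π ⟨$⟩ʳ k₀ < π ⟨$⟩ʳ k₁ →
                (π ⟨$⟩ʳ k₀ ≡ k₀ → π ⟨$⟩ʳ k₁ ≡ k₁ → ⊥) → ℓ ((s k · π) · s k) ≡ 2 + ℓ π
  ℓ-conjugate π π² πk₀<πk₁ not-fixed = begin
    ℓ ((s k · π) · s k)         ≡⟨ ℓ-ascent (π · s k) ascent-πs ⟩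
    suc (ℓ (π · s k))           ≡⟨ cong suc (sym (ℓ-flip (π · s k))) ⟩
    suc (ℓ (Perm.flip (π · s k))) ≡⟨ cong suc (ℓ-cong {u = Perm.flip (π · s k)} {v = s k · π}
                                       (λ x → trans (s-inverse (π ⟨$⟩ˡ x)) (cong σ (involution-⟨$⟩ˡ π π² x)))) ⟩
    suc (ℓ (s k · π))           ≡⟨ cong suc (ℓ-ascent π ascent-π) ⟩
    2 + ℓ π                     ∎
    where
    open ≡-Reasoning
    ascent-π : π ⟨$⟩ˡ k₀ < π ⟨$⟩ˡ k₁
    ascent-π = subst₂ _<_ (sym (involution-⟨$⟩ˡ π π² k₀)) (sym (involution-⟨$⟩ˡ π π² k₁)) πk₀<πk₁
    ascent-πs : (π · s k) ⟨$⟩ˡ k₀ < (π · s k) ⟨$⟩ˡ k₁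
    ascent-πs = subst₂ _<_ (sym (trans (s-inverse (π ⟨$⟩ˡ k₀)) (cong σ (involution-⟨$⟩ˡ π π² k₀))))
                           (sym (trans (s-inverse (π ⟨$⟩ˡ k₁)) (cong σ (involution-⟨$⟩ˡ π π² k₁))))
                           (σ-monotone πk₀<πk₁ not-fixed)

  ℓ₍ₙ₎-conjugate : (π : Permutation′ (suc m)) → Involution π → π ⟨$⟩ʳ k₀ < π ⟨$⟩ʳ k₁ →
                   (π ⟨$⟩ʳ k₀ ≡ k₀ → π ⟨$⟩ʳ k₁ ≡ k₁ → ⊥) → ℓ₍ₙ₎ ((s k · π) · s k) ≡ suc (ℓ₍ₙ₎ π)
  ℓ₍ₙ₎-conjugate π π² πk₀<πk₁ not-fixed =
    ℓ₍ₙ₎-suc {π = π} {(s k · π) · s k} (cong₂ _+_ (ℓ-conjugate π π² πk₀<πk₁ not-fixed) (exc-conjugate π πk₀≢k₁ πk₁≢k₀))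
    where
    πk₀≢k₁ : π ⟨$⟩ʳ k₀ ≢ k₁
    πk₀≢k₁ e = Fin.<-asym k₀<k₁ (subst₂ _<_ e (trans (cong (π ⟨$⟩ʳ_) (sym e)) (π² k₀)) πk₀<πk₁)
    πk₁≢k₀ : π ⟨$⟩ʳ k₁ ≢ k₀
    πk₁≢k₀ e = Fin.<-asym k₀<k₁ (subst₂ _<_ (trans (cong (π ⟨$⟩ʳ_) (sym e)) (π² k₁)) e πk₀<πk₁)

  data ActionCase (π ρ : Permutation′ (suc m)) : Set where
    stays     : π ⟨$⟩ˡ k₁ < π ⟨$⟩ˡ k₀ → ρ ≈ₚ π → ActionCase π ρ
    multiply  : ¬ (π ⟨$⟩ˡ k₁ < π ⟨$⟩ˡ k₀) → π ⟨$⟩ʳ k₀ ≡ k₀ → π ⟨$⟩ʳ k₁ ≡ k₁ →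
                (∀ x → ρ ⟨$⟩ʳ x ≡ σ (π ⟨$⟩ʳ x)) → ActionCase π ρ
    conjugate : ¬ (π ⟨$⟩ˡ k₁ < π ⟨$⟩ˡ k₀) → (π ⟨$⟩ʳ k₀ ≡ k₀ → π ⟨$⟩ʳ k₁ ≡ k₁ → ⊥) →
                (∀ x → ρ ⟨$⟩ʳ x ≡ σ (π ⟨$⟩ʳ σ x)) → ActionCase π ρ

  action-case : ∀ π → ActionCase π (sdot k π)
  action-case π with (π ⟨$⟩ˡ k₁) <? (π ⟨$⟩ˡ k₀)
  ... | yes descent = stays descent (λ x → refl)
  ... | no ¬descent with (π ⟨$⟩ʳ k₀ Fin.≟ k₀) ×-dec (π ⟨$⟩ʳ k₁ Fin.≟ k₁)
  ...   | yes (πk₀ , πk₁) = multiply ¬descent πk₀ πk₁ (λ x → refl)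
  ...   | no not-fixed    = conjugate ¬descent (λ πk₀ πk₁ → not-fixed (πk₀ , πk₁)) (λ x → refl)

Involution-cong : {π ρ : Permutation′ n} → ρ ≈ₚ π → Involution π → Involution ρ
Involution-cong {π = π} {ρ} ρ≈π π² x = trans (ρ≈π (ρ ⟨$⟩ʳ x)) (trans (cong (π ⟨$⟩ʳ_) (ρ≈π x)) (π² x))

-- Reduced words satisfy the criterion

Criterion : (π w : Permutation′ n) → Set
Criterion π w = WCriterion (π ⟨$⟩ʳ_) (w ⟨$⟩ˡ_)

⟨$⟩ˡ-injective : (w : Permutation′ n) → ∀ {x y} → w ⟨$⟩ˡ x ≡ w ⟨$⟩ˡ y → x ≡ y
⟨$⟩ˡ-injective w {x} {y} e = trans (sym (Perm.inverseʳ w)) (trans (cong (w ⟨$⟩ʳ_) e) (Perm.inverseʳ w))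

module Commutation {m : ℕ} (k : Fin m) (π : Permutation′ (suc m)) (π² : Involution π) where
  open Adjacent k

  swapped-partner : π ⟨$⟩ʳ k₀ ≡ k₁ → π ⟨$⟩ʳ k₁ ≡ k₀
  swapped-partner πk₀ = trans (cong (π ⟨$⟩ʳ_) (sym πk₀)) (π² k₀)

  σ-commutes-fixed : π ⟨$⟩ʳ k₀ ≡ k₀ → π ⟨$⟩ʳ k₁ ≡ k₁ → ∀ y → π ⟨$⟩ʳ (σ y) ≡ σ (π ⟨$⟩ʳ y)
  σ-commutes-fixed πk₀ πk₁ y with position y
  ... | at-k₀ refl = trans (cong (π ⟨$⟩ʳ_) σ-k₀) (trans πk₁ (trans (sym σ-k₀) (cong σ (sym πk₀))))
  ... | at-k₁ refl = trans (cong (π ⟨$⟩ʳ_) σ-k₁) (trans πk₀ (trans (sym σ-k₁) (cong σ (sym πk₁))))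
  ... | elsewhere y≢k₀ y≢k₁ = trans (cong (π ⟨$⟩ʳ_) (σ-other y y≢k₀ y≢k₁)) (sym (σ-other _ πy≢k₀ πy≢k₁))
    where
    πy≢k₀ : π ⟨$⟩ʳ y ≢ k₀
    πy≢k₀ e = y≢k₀ (trans (sym (π² y)) (trans (cong (π ⟨$⟩ʳ_) e) πk₀))
    πy≢k₁ : π ⟨$⟩ʳ y ≢ k₁
    πy≢k₁ e = y≢k₁ (trans (sym (π² y)) (trans (cong (π ⟨$⟩ʳ_) e) πk₁))

  σ-commutes-swapped : π ⟨$⟩ʳ k₀ ≡ k₁ → ∀ y → π ⟨$⟩ʳ (σ y) ≡ σ (π ⟨$⟩ʳ y)
  σ-commutes-swapped πk₀ y with position y
  ... | at-k₀ refl = trans (cong (π ⟨$⟩ʳ_) σ-k₀) (trans (swapped-partner πk₀) (trans (sym σ-k₁) (cong σ (sym πk₀))))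
  ... | at-k₁ refl = trans (cong (π ⟨$⟩ʳ_) σ-k₁) (trans πk₀ (trans (sym σ-k₀) (cong σ (sym (swapped-partner πk₀)))))
  ... | elsewhere y≢k₀ y≢k₁ = trans (cong (π ⟨$⟩ʳ_) (σ-other y y≢k₀ y≢k₁)) (sym (σ-other _ πy≢k₀ πy≢k₁))
    where
    πy≢k₀ : π ⟨$⟩ʳ y ≢ k₀
    πy≢k₀ e = y≢k₁ (trans (sym (π² y)) (trans (cong (π ⟨$⟩ʳ_) e) πk₀))
    πy≢k₁ : π ⟨$⟩ʳ y ≢ k₁
    πy≢k₁ e = y≢k₀ (trans (sym (π² y)) (trans (cong (π ⟨$⟩ʳ_) e) (swapped-partner πk₀)))

  σπ-involution : (∀ y → π ⟨$⟩ʳ (σ y) ≡ σ (π ⟨$⟩ʳ y)) → Involution (s k · π)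
  σπ-involution commutes x = trans (cong σ (commutes (π ⟨$⟩ʳ x))) (trans (σ-involutive _) (π² x))

  σπσ-involution : Involution ((s k · π) · s k)
  σπσ-involution x =
    trans (cong (λ z → σ (π ⟨$⟩ʳ z)) (σ-involutive _)) (trans (cong σ (π² _)) (σ-involutive x))

record WordInvariant {m : ℕ} (w π : Permutation′ (suc m)) (len : ℕ) : Set where
  field
    involution : Involution π
    ℓ₍ₙ₎≤len   : ℓ₍ₙ₎ π ℕ.≤ len
    ℓ≤len      : ℓ w ℕ.≤ len
    criterion  : ℓ w ≡ len → ℓ₍ₙ₎ π ≡ len → Criterion π w

module ForwardStep {m : ℕ} (k : Fin m) where
  open Adjacent k
  open LengthSteps k
  open CriterionSteps k

  ℓ-s·-≤ : ∀ {len} (w : Permutation′ (suc m)) → ℓ w ℕ.≤ len → ℓ (s k · w) ℕ.≤ suc len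
  ℓ-s·-≤ {len} w ℓw≤ with ascent-or-descent w
  ... | inj₁ ascent  = subst (ℕ._≤ suc len) (sym (ℓ-ascent w ascent)) (s≤s ℓw≤)
  ... | inj₂ descent = ℕ.m≤n⇒m≤1+n (ℕ.≤-trans (ℕ.n≤1+n _) (subst (ℕ._≤ len) (sym (ℓ-descent w descent)) ℓw≤))

  tight-ascent : ∀ {len} (w : Permutation′ (suc m)) → ℓ w ℕ.≤ len → ℓ (s k · w) ≡ suc len →
                 w ⟨$⟩ˡ k₀ < w ⟨$⟩ˡ k₁ × ℓ w ≡ len
  tight-ascent {len} w ℓw≤ tight with ascent-or-descent w
  ... | inj₁ ascent  = ascent , ℕ.suc-injective (trans (sym (ℓ-ascent w ascent)) tight)
  ... | inj₂ descent = ⊥-elim (ℕ.<-irrefl refl (ℕ.≤-trans too-long (ℕ.n≤1+n len)))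
    where
    too-long : suc (suc len) ℕ.≤ len
    too-long = subst (ℕ._≤ len) (trans (sym (ℓ-descent w descent)) (cong suc tight)) ℓw≤

  involution-ascent : (π : Permutation′ (suc m)) → Involution π → ¬ (π ⟨$⟩ˡ k₁ < π ⟨$⟩ˡ k₀) →
                      π ⟨$⟩ʳ k₀ < π ⟨$⟩ʳ k₁
  involution-ascent π π² ¬descent with ascent-or-descent π
  ... | inj₁ ascent  = subst₂ _<_ (involution-⟨$⟩ˡ π π² k₀) (involution-⟨$⟩ˡ π π² k₁) ascent
  ... | inj₂ descent = ⊥-elim (¬descent descent)

  module _ {len : ℕ} {w π : Permutation′ (suc m)} (I : WordInvariant w π len) where
    open WordInvariant I

    invariant-stays : sdot k π ≈ₚ π → WordInvariant (s k · w) (sdot k π) (suc len)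
    invariant-stays ρ≈π = record
      { involution = Involution-cong {π = π} {sdot k π} ρ≈π involution
      ; ℓ₍ₙ₎≤len = subst (ℕ._≤ suc len) (sym ℓ₍ₙ₎ρ) (ℕ.m≤n⇒m≤1+n ℓ₍ₙ₎≤len)
      ; ℓ≤len = ℓ-s·-≤ w ℓ≤len
      ; criterion = λ _ tight → ⊥-elim (ℕ.<-irrefl refl (subst (ℕ._≤ len) (trans (sym ℓ₍ₙ₎ρ) tight) ℓ₍ₙ₎≤len))
      }
      where
      ℓ₍ₙ₎ρ : ℓ₍ₙ₎ (sdot k π) ≡ ℓ₍ₙ₎ π
      ℓ₍ₙ₎ρ = ℓ₍ₙ₎-cong {u = sdot k π} {v = π} ρ≈π

    invariant-multiply : π ⟨$⟩ʳ k₀ ≡ k₀ → π ⟨$⟩ʳ k₁ ≡ k₁ → (∀ x → sdot k π ⟨$⟩ʳ x ≡ σ (π ⟨$⟩ʳ x)) →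
                         WordInvariant (s k · w) (sdot k π) (suc len)
    invariant-multiply πk₀ πk₁ ρ≈σπ = record
      { involution = Involution-cong {π = s k · π} {sdot k π} ρ≈σπ (σπ-involution (σ-commutes-fixed πk₀ πk₁))
      ; ℓ₍ₙ₎≤len = subst (ℕ._≤ suc len) (sym ℓ₍ₙ₎ρ) (s≤s ℓ₍ₙ₎≤len)
      ; ℓ≤len = ℓ-s·-≤ w ℓ≤len
      ; criterion = λ tightw tightπ → let (ascent , ℓw≡len) = tight-ascent w ℓ≤len tightw in
          WCriterion-cong (λ x → sym (ρ≈σπ x)) (λ x → sym (s·-⟨$⟩ˡ w x))
            (ascent-at-fixed-pair (criterion ℓw≡len (ℕ.suc-injective (trans (sym ℓ₍ₙ₎ρ) tightπ))) πk₀ πk₁ ascent)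
      }
      where
      open Commutation k π involution
      ℓ₍ₙ₎ρ : ℓ₍ₙ₎ (sdot k π) ≡ suc (ℓ₍ₙ₎ π)
      ℓ₍ₙ₎ρ = trans (ℓ₍ₙ₎-cong {u = sdot k π} {v = s k · π} ρ≈σπ) (ℓ₍ₙ₎-fixed π involution πk₀ πk₁)

    invariant-conjugate : ¬ (π ⟨$⟩ˡ k₁ < π ⟨$⟩ˡ k₀) → (π ⟨$⟩ʳ k₀ ≡ k₀ → π ⟨$⟩ʳ k₁ ≡ k₁ → ⊥) →
                          (∀ x → sdot k π ⟨$⟩ʳ x ≡ σ (π ⟨$⟩ʳ σ x)) → WordInvariant (s k · w) (sdot k π) (suc len)
    invariant-conjugate ¬descent not-fixed ρ≈σπσ = record
      { involution = Involution-cong {π = (s k · π) · s k} {sdot k π} ρ≈σπσ σπσ-involution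
      ; ℓ₍ₙ₎≤len = subst (ℕ._≤ suc len) (sym ℓ₍ₙ₎ρ) (s≤s ℓ₍ₙ₎≤len)
      ; ℓ≤len = ℓ-s·-≤ w ℓ≤len
      ; criterion = λ tightw tightπ → let (ascent , ℓw≡len) = tight-ascent w ℓ≤len tightw in
          WCriterion-cong (λ x → sym (ρ≈σπσ x)) (λ x → sym (s·-⟨$⟩ˡ w x))
            (ascent-conjugate (criterion ℓw≡len (ℕ.suc-injective (trans (sym ℓ₍ₙ₎ρ) tightπ))) ascent πk₀<πk₁ not-fixed)
      }
      where
      open Commutation k π involution
      πk₀<πk₁ : π ⟨$⟩ʳ k₀ < π ⟨$⟩ʳ k₁
      πk₀<πk₁ = involution-ascent π involution ¬descent
      ℓ₍ₙ₎ρ : ℓ₍ₙ₎ (sdot k π) ≡ suc (ℓ₍ₙ₎ π)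
      ℓ₍ₙ₎ρ = trans (ℓ₍ₙ₎-cong {u = sdot k π} {v = (s k · π) · s k} ρ≈σπσ) (ℓ₍ₙ₎-conjugate π involution πk₀<πk₁ not-fixed)

    word-invariant-step : WordInvariant (s k · w) (sdot k π) (suc len)
    word-invariant-step with action-case π
    ... | stays _ ρ≈π                          = invariant-stays ρ≈π
    ... | multiply _ πk₀ πk₁ ρ≈σπ              = invariant-multiply πk₀ πk₁ ρ≈σπ
    ... | conjugate ¬descent not-fixed ρ≈σπσ   = invariant-conjugate ¬descent not-fixed ρ≈σπσ

word-invariant : ∀ {m} (ks : List (Fin m)) → WordInvariant (word ks) (act ks e) (length ks)
word-invariant {m} [] = record
  { involution = λ x → refl
  ; ℓ₍ₙ₎≤len = ℕ.≤-reflexive (ℓ₍ₙ₎-e {suc m})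
  ; ℓ≤len = ℕ.≤-reflexive (ℓ-e {suc m})
  ; criterion = λ _ _ → WCriterion-id
  }
word-invariant (k ∷ ks) = ForwardStep.word-invariant-step k (word-invariant ks)

InW⇒Criterion : ∀ {m} {π w : Permutation′ (suc m)} → InW π w → Criterion π w
InW⇒Criterion {π = π} {w} ((ks , (word≈w , length≡ℓ) , act≈π) , ℓw≡ℓ₍ₙ₎π) =
  WCriterion-cong act≈π (⟨$⟩ˡ-cong {u = word ks} {v = w} word≈w) (criterion tightw tightπ)
  where
  open WordInvariant (word-invariant ks)
  tightw : ℓ (word ks) ≡ length ks
  tightw = trans (ℓ-cong {u = word ks} {v = w} word≈w) (sym length≡ℓ)
  tightπ : ℓ₍ₙ₎ (act ks e) ≡ length ks
  tightπ = trans (ℓ₍ₙ₎-cong {u = act ks e} {v = π} act≈π) (trans (sym ℓw≡ℓ₍ₙ₎π) (sym length≡ℓ))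

-- The criterion yields reduced words

module BackwardStep {m : ℕ} (k : Fin m) where
  open Adjacent k
  open LengthSteps k
  open CriterionSteps k

  prepend-reduced : ∀ {w : Permutation′ (suc m)} {ks} → w ⟨$⟩ˡ k₁ < w ⟨$⟩ˡ k₀ →
                    ReducedWord (s k · w) ks → ReducedWord w (k ∷ ks)
  prepend-reduced {w} descent (word≈ , length≡ℓ) =
    (λ x → trans (cong σ (word≈ x)) (σ-involutive _)) , trans (cong suc length≡ℓ) (ℓ-descent w descent)

  module Lift {w π π′ : Permutation′ (suc m)} (descent : w ⟨$⟩ˡ k₁ < w ⟨$⟩ˡ k₀) (π′² : Involution π′) where

    ⟨$⟩ˡ≡π′ : ∀ {A} → A ≈ₚ π′ → ∀ x → A ⟨$⟩ˡ x ≡ π′ ⟨$⟩ʳ x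
    ⟨$⟩ˡ≡π′ {A} A≈π′ x = trans (⟨$⟩ˡ-cong {u = A} {v = π′} A≈π′ x) (involution-⟨$⟩ˡ π′ π′² x)

    ℓ≡ℓ₍ₙ₎-prepended : ℓ (s k · w) ≡ ℓ₍ₙ₎ π′ → ℓ₍ₙ₎ π ≡ suc (ℓ₍ₙ₎ π′) → ℓ w ≡ ℓ₍ₙ₎ π
    ℓ≡ℓ₍ₙ₎-prepended ℓ≡ℓ₍ₙ₎ ℓ₍ₙ₎π = trans (sym (ℓ-descent w descent)) (trans (cong suc ℓ≡ℓ₍ₙ₎) (sym ℓ₍ₙ₎π))

    lift-multiply : π′ ⟨$⟩ʳ k₀ ≡ k₀ → π′ ⟨$⟩ʳ k₁ ≡ k₁ → (∀ x → π ⟨$⟩ʳ x ≡ σ (π′ ⟨$⟩ʳ x)) →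
                    InW π′ (s k · w) → InW π w
    lift-multiply π′k₀ π′k₁ π≈σπ′ ((ks , reduced , act≈π′) , ℓ≡ℓ₍ₙ₎) =
      (k ∷ ks , prepend-reduced {w = w} {ks} descent reduced , act≈π) , ℓ≡ℓ₍ₙ₎-prepended ℓ≡ℓ₍ₙ₎ ℓ₍ₙ₎π
      where
      act≈π : sdot k (act ks e) ≈ₚ π
      act≈π with action-case (act ks e)
      ... | stays descentA _ = ⊥-elim (Fin.<-asym k₀<k₁
            (subst₂ _<_ (trans (⟨$⟩ˡ≡π′ {act ks e} act≈π′ k₁) π′k₁) (trans (⟨$⟩ˡ≡π′ {act ks e} act≈π′ k₀) π′k₀) descentA))
      ... | multiply _ _ _ ρ≈σA = λ x → trans (ρ≈σA x) (trans (cong σ (act≈π′ x)) (sym (π≈σπ′ x)))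
      ... | conjugate _ not-fixed _ = ⊥-elim (not-fixed (trans (act≈π′ k₀) π′k₀) (trans (act≈π′ k₁) π′k₁))
      ℓ₍ₙ₎π : ℓ₍ₙ₎ π ≡ suc (ℓ₍ₙ₎ π′)
      ℓ₍ₙ₎π = trans (ℓ₍ₙ₎-cong {u = π} {v = s k · π′} π≈σπ′) (ℓ₍ₙ₎-fixed π′ π′² π′k₀ π′k₁)

    lift-conjugate : π′ ⟨$⟩ʳ k₀ < π′ ⟨$⟩ʳ k₁ → (π′ ⟨$⟩ʳ k₀ ≡ k₀ → π′ ⟨$⟩ʳ k₁ ≡ k₁ → ⊥) →
                     (∀ x → π ⟨$⟩ʳ x ≡ σ (π′ ⟨$⟩ʳ σ x)) → InW π′ (s k · w) → InW π w
    lift-conjugate π′k₀<π′k₁ not-fixed π≈σπ′σ ((ks , reduced , act≈π′) , ℓ≡ℓ₍ₙ₎) =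
      (k ∷ ks , prepend-reduced {w = w} {ks} descent reduced , act≈π) , ℓ≡ℓ₍ₙ₎-prepended ℓ≡ℓ₍ₙ₎ ℓ₍ₙ₎π
      where
      act≈π : sdot k (act ks e) ≈ₚ π
      act≈π with action-case (act ks e)
      ... | stays descentA _ =
            ⊥-elim (Fin.<-asym π′k₀<π′k₁ (subst₂ _<_ (⟨$⟩ˡ≡π′ {act ks e} act≈π′ k₁) (⟨$⟩ˡ≡π′ {act ks e} act≈π′ k₀) descentA))
      ... | multiply _ Ak₀ Ak₁ _ = ⊥-elim (not-fixed (trans (sym (act≈π′ k₀)) Ak₀) (trans (sym (act≈π′ k₁)) Ak₁))
      ... | conjugate _ _ ρ≈σAσ = λ x → trans (ρ≈σAσ x) (trans (cong σ (act≈π′ (σ x))) (sym (π≈σπ′σ x)))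
      ℓ₍ₙ₎π : ℓ₍ₙ₎ π ≡ suc (ℓ₍ₙ₎ π′)
      ℓ₍ₙ₎π = trans (ℓ₍ₙ₎-cong {u = π} {v = (s k · π′) · s k} π≈σπ′σ) (ℓ₍ₙ₎-conjugate π′ π′² π′k₀<π′k₁ not-fixed)

  descent-step : (w π : Permutation′ (suc m)) → Involution π → Criterion π w → w ⟨$⟩ˡ k₁ < w ⟨$⟩ˡ k₀ →
                 Σ[ π′ ∈ Permutation′ (suc m) ] Involution π′ × Criterion π′ (s k · w) × (InW π′ (s k · w) → InW π w)
  descent-step w π π² C descent with π ⟨$⟩ʳ k₀ Fin.≟ k₁
  ... | yes πk₀ =
        s k · π , π′² , WCriterion-cong (λ x → refl) (λ x → sym (s·-⟨$⟩ˡ w x)) (descent-at-swapped-pair C descent πk₀) ,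
        Lift.lift-multiply {w} {π} {s k · π} descent π′² (trans (cong σ πk₀) σ-k₁) π′k₁ (λ x → sym (σ-involutive _))
    where
    open Commutation k π π²
    π′² : Involution (s k · π)
    π′² = σπ-involution (σ-commutes-swapped πk₀)
    π′k₁ : σ (π ⟨$⟩ʳ k₁) ≡ k₁
    π′k₁ = trans (cong σ (swapped-partner πk₀)) σ-k₀
  ... | no πk₀≢k₁ =
        (s k · π) · s k , σπσ-involution ,
        WCriterion-cong (λ x → refl) (λ x → sym (s·-⟨$⟩ˡ w x)) (descent-conjugate C (⟨$⟩ˡ-injective w) descent πk₀≢k₁) ,
        Lift.lift-conjugate {w} {π} {(s k · π) · s k} descent σπσ-involution π′k₀<π′k₁ not-fixed
          (λ x → sym (trans (σ-involutive _) (cong (π ⟨$⟩ʳ_) (σ-involutive x))))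
    where
    open Commutation k π π²
    πk₁<πk₀ : π ⟨$⟩ʳ k₁ < π ⟨$⟩ʳ k₀
    πk₁<πk₀ = descent-reverses-f C descent
    π′k₀<π′k₁ : σ (π ⟨$⟩ʳ σ k₀) < σ (π ⟨$⟩ʳ σ k₁)
    π′k₀<π′k₁ = subst₂ _<_ (cong (λ z → σ (π ⟨$⟩ʳ z)) (sym σ-k₀)) (cong (λ z → σ (π ⟨$⟩ʳ z)) (sym σ-k₁))
                  (σ-monotone πk₁<πk₀ (λ _ πk₀≡k₁ → πk₀≢k₁ πk₀≡k₁))
    not-fixed : σ (π ⟨$⟩ʳ σ k₀) ≡ k₀ → σ (π ⟨$⟩ʳ σ k₁) ≡ k₁ → ⊥
    not-fixed π′k₀ π′k₁ = Fin.<-asym k₀<k₁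
      (subst₂ _<_ (σ-injective (trans (cong (λ z → σ (π ⟨$⟩ʳ z)) (sym σ-k₀)) (trans π′k₀ (sym σ-k₁))))
                  (σ-injective (trans (cong (λ z → σ (π ⟨$⟩ʳ z)) (sym σ-k₁)) (trans π′k₁ (sym σ-k₀)))) πk₁<πk₀)

module Increasing {m : ℕ} (g : Fin (suc m) → Fin (suc m)) (increasing : ∀ (k : Fin m) → g (inject₁ k) < g (Fin.suc k)) where

  -- The induction runs on an explicit counter: inject₁ k is not structurally smaller than suc k.
  ≥-self : ∀ i (x : Fin (suc m)) → toℕ x ≡ i → i ℕ.≤ toℕ (g x)
  ≥-self zero x _ = z≤n
  ≥-self (suc i) (Fin.suc k) x≡i =
    ℕ.≤-<-trans (≥-self i (inject₁ k) (trans (Fin.toℕ-inject₁ k) (ℕ.suc-injective x≡i))) (increasing k)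

  ≤-self : ∀ d (x : Fin (suc m)) → toℕ x + d ≡ m → toℕ (g x) ℕ.≤ toℕ x
  ≤-self zero x x+0≡m = subst (toℕ (g x) ℕ.≤_) (sym (trans (sym (ℕ.+-identityʳ (toℕ x))) x+0≡m)) (Fin.toℕ≤pred[n] (g x))
  ≤-self (suc d) x x+d≡m = subst (λ z → toℕ (g z) ℕ.≤ toℕ z) (Fin.inject₁-lower₁ x m≢x) (ℕ.≤-pred step)
    where
    m≢x : m ≢ toℕ x
    m≢x m≡x = ℕ.m+1+n≢m (toℕ x) (trans x+d≡m m≡x)
    k : Fin m
    k = Fin.lower₁ x m≢x
    k≡x : toℕ k ≡ toℕ x
    k≡x = trans (sym (Fin.toℕ-inject₁ k)) (cong toℕ (Fin.inject₁-lower₁ x m≢x))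
    step : toℕ (g (inject₁ k)) ℕ.< suc (toℕ (inject₁ k))
    step = subst (λ z → toℕ (g (inject₁ k)) ℕ.< suc z) (sym (Fin.toℕ-inject₁ k))
      (ℕ.<-≤-trans (increasing k)
        (≤-self d (Fin.suc k) (trans (cong (λ z → suc z + d) k≡x) (trans (sym (ℕ.+-suc (toℕ x) d)) x+d≡m))))

  increasing⇒id : ∀ x → g x ≡ x
  increasing⇒id x = Fin.toℕ-injective (ℕ.≤-antisym (≤-self (m ∸ toℕ x) x (ℕ.m+[n∸m]≡n (Fin.toℕ≤pred[n] x)))
                                                   (≥-self (toℕ x) x refl))

ascending⇒InW : ∀ {m} (w π : Permutation′ (suc m)) → Criterion π w →
                (∀ (k : Fin m) → ¬ (w ⟨$⟩ˡ Fin.suc k < w ⟨$⟩ˡ inject₁ k)) → InW π w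
ascending⇒InW {m} w π C no-descent = ([] , ((λ x → sym (w≈e x)) , sym ℓw≡0) , (λ x → sym (π≈e x))) , trans ℓw≡0 (sym ℓ₍ₙ₎π≡0)
  where
  w⁻¹≗id : ∀ x → w ⟨$⟩ˡ x ≡ x
  w⁻¹≗id = Increasing.increasing⇒id (w ⟨$⟩ˡ_)
    (λ k → ≮∧≢⇒> (no-descent k) (λ e → Adjacent.k₀≢k₁ k (sym (⟨$⟩ˡ-injective w e))))
  w≈e : w ≈ₚ e
  w≈e x = trans (cong (w ⟨$⟩ʳ_) (sym (w⁻¹≗id x))) (Perm.inverseʳ w)
  π≈e : π ≈ₚ e
  π≈e = WCriterionProperties.p-id⇒f-id C w⁻¹≗id
  ℓw≡0 : ℓ w ≡ 0
  ℓw≡0 = trans (ℓ-cong {u = w} {v = e} w≈e) (ℓ-e {suc m})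
  ℓ₍ₙ₎π≡0 : ℓ₍ₙ₎ π ≡ 0
  ℓ₍ₙ₎π≡0 = trans (ℓ₍ₙ₎-cong {u = π} {v = e} π≈e) (ℓ₍ₙ₎-e {suc m})

Criterion⇒InW : ∀ {m} (N : ℕ) (w π : Permutation′ (suc m)) → ℓ w ≡ N → Involution π → Criterion π w → InW π w
Criterion⇒InW {m} N w π ℓw≡N π² C with Fin.any? (λ (k : Fin m) → w ⟨$⟩ˡ Fin.suc k <? w ⟨$⟩ˡ inject₁ k)
... | no no-descent = ascending⇒InW w π C (λ k descent → no-descent (k , descent))
... | yes (k , descent) with N | BackwardStep.descent-step k w π π² C descent
...   | zero  | _ = ⊥-elim (ℕ.1+n≢0 (trans (LengthSteps.ℓ-descent k w descent) ℓw≡N))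
...   | suc N | (π′ , π′² , C′ , lift) =
        lift (Criterion⇒InW N (s k · w) π′ (ℕ.suc-injective (trans (LengthSteps.ℓ-descent k w descent) ℓw≡N)) π′² C′)

-- The longest involution

2*[x+1]≡sx+sx : ∀ x → 2 * (x + 1) ≡ suc x + suc x
2*[x+1]≡sx+sx = solve 1 (λ x → con 2 :* (x :+ con 1) := (con 1 :+ x) :+ (con 1 :+ x)) refl
  where open +-*-Solver

lower-half⇒<opposite : (v : Fin n) → 2 * (toℕ v + 1) ℕ.≤ n → v < opposite v
lower-half⇒<opposite {n} v le = subst (suc (toℕ v) ℕ.≤_) (sym (Fin.opposite-prop v))
  (ℕ.m+n≤o⇒m≤o∸n (suc (toℕ v)) (subst (ℕ._≤ n) (2*[x+1]≡sx+sx (toℕ v)) le))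

<opposite⇒lower-half : (v : Fin n) → v < opposite v → 2 * (toℕ v + 1) ℕ.≤ n
<opposite⇒lower-half {n} v v<v̄ = subst (ℕ._≤ n) (sym (2*[x+1]≡sx+sx (toℕ v)))
  (subst (suc (toℕ v) + suc (toℕ v) ℕ.≤_) (ℕ.m+[n∸m]≡n (Fin.toℕ<n v))
    (ℕ.+-monoʳ-≤ (suc (toℕ v)) (subst (suc (toℕ v) ℕ.≤_) (Fin.opposite-prop v) v<v̄)))

opposite-reverses-< : {a b : Fin n} → a < b → opposite b < opposite a
opposite-reverses-< {a = a} {b} a<b = subst₂ ℕ._<_ (sym (Fin.opposite-prop b)) (sym (Fin.opposite-prop a))
  (ℕ.∸-monoʳ-< (s≤s a<b) (Fin.toℕ<n b))

Criterion-π₀⇒InD : (w : Permutation′ n) → Criterion π₀ w → InD w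
Criterion-π₀⇒InD w C v lower-half =
  cycle-reversed v (lower-half⇒<opposite v lower-half) , λ j v<j j<v̄ (l₁ , l₂) → cycle-uninterrupted v j v<j j<v̄ l₁ l₂
  where open WCriterion C

InD⇒Criterion-π₀ : (w : Permutation′ n) → InD w → Criterion π₀ w
InD⇒Criterion-π₀ w D = record
  { involutive = Fin.opposite-involutive
  ; cycle-reversed = λ a a<ā → proj₁ (D a (<opposite⇒lower-half a a<ā))
  ; cycle-uninterrupted = λ a c a<c c<ā l₁ l₂ →
      proj₂ (D a (<opposite⇒lower-half a (Fin.<-trans a<c c<ā))) c a<c c<ā (l₁ , l₂)
  ; cycles-ordered = λ a b _ _ a<b ā<b̄ → ⊥-elim (Fin.<-asym ā<b̄ (opposite-reverses-< a<b))
  }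

theorem3p7 : ∀ (m : ℕ) (w : Permutation′ (suc m)) →
    (InW π₀ w → InD w) × (InD w → InW π₀ w)
theorem3p7 m w =
  (λ w∈W → Criterion-π₀⇒InD w (InW⇒Criterion {π = π₀} {w} w∈W)) ,
  (λ w∈D → Criterion⇒InW (ℓ w) w π₀ refl Fin.opposite-involutive (InD⇒Criterion-π₀ w w∈D))
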